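{- Let $n\ge1$ be an integer and let $a\ge1$, $b$ be integers with $0\le b\le a$. Put $\sigma_n=(-1)^{n-1}$. Then $$ {\begin{bmatrix}an\\ bn\end{bmatrix}}_q\,\sigma_n^b\,q^{\binom{bn}2} \equiv\binom{a-1}b+\binom{a-1}{a-b}\sigma_n^a\,q^{\binom{an}2}\pmod{\Phi_n(q)^2}. $$
   Context: For a non-negative integer $m$, $[m]=[m]_q=(1-q^m)/(1-q)\in\mathbb Z[q]$, $[m]!=[1][2]\cdots[m]$, and for $0\le k\le m$ the $q$-binomial coefficient is ${\begin{bmatrix}m\\ k\end{bmatrix}}_q=\frac{[m]!}{[k]!\,[m-k]!}\in\mathbb Z[q]$. $\Phi_n(q)$ denotes the $n$-th cyclotomic polynomial. Ordinary binomial coefficients $\binom{m}{k}$ are the usual ones (zero when $k>m\ge0$). -}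

module Defs where

open import Data.Nat as ℕ using (ℕ; zero; suc; _∸_; _<ᵇ_)
open import Data.Nat.Divisibility using (_∣?_)
open import Data.Integer as ℤ using (ℤ; +_; -_; 0ℤ; 1ℤ; -1ℤ)
open import Data.List using (List; []; _∷_; _++_; replicate; reverse; length; map)
open import Data.List.Relation.Unary.All using (All)
open import Data.Product using (Σ)
open import Data.Bool using (Bool; true; false; if_then_else_)
open import Relation.Nullary.Decidable using (does)
open import Relation.Binary.PropositionalEquality using (_≡_)

-- Polynomials in ℤ[q], as coefficient lists (constant term first).
-- Trailing zeros are allowed; equality is taken up to them (_≈ₚ_).

Poly : Set
Poly = List ℤ

infixl 6 _+ₚ_ _-ₚ_
infixl 7 _*ₚ_
infix 4 _≈ₚ_

_+ₚ_ : Poly → Poly → Poly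
[] +ₚ q = q
(a ∷ p) +ₚ [] = a ∷ p
(a ∷ p) +ₚ (b ∷ q) = (a ℤ.+ b) ∷ (p +ₚ q)

negₚ : Poly → Poly
negₚ = map -_

_-ₚ_ : Poly → Poly → Poly
p -ₚ q = p +ₚ negₚ q

scaleₚ : ℤ → Poly → Poly
scaleₚ c = map (c ℤ.*_)

_*ₚ_ : Poly → Poly → Poly
[] *ₚ q = []
(a ∷ p) *ₚ q = scaleₚ a q +ₚ (0ℤ ∷ (p *ₚ q))

constₚ : ℤ → Poly
constₚ c = c ∷ []

Xpow : ℕ → Poly
Xpow k = replicate k 0ℤ ++ (1ℤ ∷ [])

_≈ₚ_ : Poly → Poly → Set
p ≈ₚ q = All (_≡ 0ℤ) (p -ₚ q)

CongMod : Poly → Poly → Poly → Set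
CongMod A B M = Σ Poly λ C → (A -ₚ B) ≈ₚ (C *ₚ M)

isZeroℤ : ℤ → Bool
isZeroℤ (+ zero) = true
isZeroℤ _ = false

dropZeros : List ℤ → List ℤ
dropZeros [] = []
dropZeros (a ∷ p) = if isZeroℤ a then dropZeros p else a ∷ p

normalize : Poly → Poly
normalize p = reverse (dropZeros (reverse p))

lastCoeff : Poly → ℤ
lastCoeff [] = 0ℤ
lastCoeff (a ∷ []) = a
lastCoeff (a ∷ b ∷ p) = lastCoeff (b ∷ p)

divFuel : ℕ → Poly → Poly → Poly
divFuel zero p d = []
divFuel (suc f) p d =
  let p' = normalize p
      d' = normalize d
  in if length p' <ᵇ length d' then []
     else (let t = scaleₚ (lastCoeff p') (Xpow (length p' ∸ length d'))
           in t +ₚ divFuel f (p' -ₚ t *ₚ d') d')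

-- p / d for monic d (the exact quotient when d ∣ p)
divMonic : Poly → Poly → Poly
divMonic p d = divFuel (suc (length p)) p d

qint : ℕ → Poly
qint m = replicate m 1ℤ

qfact : ℕ → Poly
qfact zero = constₚ 1ℤ
qfact (suc m) = qfact m *ₚ qint (suc m)

qbinom : ℕ → ℕ → Poly
qbinom m k = divMonic (qfact m) (qfact k *ₚ qfact (m ∸ k))

-- Cyclotomic polynomials, via  q^n - 1 = ∏_{d ∣ n} Φ_d(q).

-- product of Φ_d (d = 1..length list, list = [Φ_1,...,Φ_k]) over d ∣ m
prodDivs : ℕ → ℕ → List Poly → Poly
prodDivs m d [] = constₚ 1ℤ
prodDivs m d (φ ∷ φs) =
  (if does (d ∣? m) then φ else constₚ 1ℤ) *ₚ prodDivs m (suc d) φs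

-- cycList n = [Φ_1, ..., Φ_n]
cycList : ℕ → List Poly
cycList zero = []
cycList (suc n) =
  cycList n ++
  (divMonic (Xpow (suc n) -ₚ constₚ 1ℤ) (prodDivs (suc n) 1 (cycList n)) ∷ [])

lastPoly : List Poly → Poly
lastPoly [] = constₚ 1ℤ
lastPoly (p ∷ []) = p
lastPoly (p ∷ q ∷ ps) = lastPoly (q ∷ ps)

-- Φ_n(q) for n ≥ 1 (Φ_0 is a meaningless placeholder)
Φ : ℕ → Poly
Φ n = normalize (lastPoly (cycList n))

σ : ℕ → ℤ
σ n = -1ℤ ℤ.^ (n ∸ 1)

module Submission where

-- Hence the division-defined 'qbinom'
--     equals the Pascal-defined 'qbin', and a monic M dividing c·Q (c ≥ 1) divides Q.
--   * The list-defined Φ_d satisfy q^N - 1 = ∏_{d ∣ N} Φ_d with every Φ_d monic (strong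
--     induction on N; distinct Φ_d generate an ideal containing a positive integer, found by
--     Euclid's algorithm on exponents of q^a - 1).
--   * Pascal's rule gives the q-Vandermonde identity and Σ_k (-1)^k q^(k choose 2) qbin n k = 0.
--   * Modulo Φ_n: Φ_n ∣ qbin n i for 0 < i < n, so the alternating sum yields
--     σ_n q^(n choose 2) ≡ 1; with q^n ≡ 1 and Vandermonde, Φ_n ∣ qbin (an) k when n ∤ k.
--   * Modulo Φ_n² only two Vandermonde terms survive, giving a Pascal-type recursion in a
--     that proves the theorem by induction on a.

open import Defs
open import Data.Nat using (ℕ; zero; suc; _+_; _*_; _∸_; _≤_; _<_; z≤n; s≤s; _<ᵇ_)
open import Data.Nat.Divisibility
  using (_∣_; divides; _∣?_; _∣0; ∣-refl; ∣-trans; ∣⇒≤; ∣-antisym; 0∣⇒≡0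
        ; ∣m∸n∣n⇒∣m; ∣m+n∣m⇒∣n; ∣m∣n⇒∣m+n; n∣m*n)
import Data.Nat.Properties as ℕP
import Data.Nat.Tactic.RingSolver as ℕS
open import Data.Nat.Combinatorics
  using (_C_; nCk≡nC[n∸k]; nCn≡1; nCk+nC[k+1]≡[n+1]C[k+1]; k>n⇒nCk≡0; nC1≡n)
open import Data.Integer as ℤ using (ℤ; +_; -_; 0ℤ; 1ℤ; -1ℤ)
  renaming (_+_ to _+ℤ_; _*_ to _*ℤ_; _-_ to _-ℤ_)
import Data.Integer.Properties as ℤP
import Algebra.Properties.CommutativeSemigroup ℤP.+-commutativeSemigroup as ℤ+
open import Data.List using (List; []; _∷_; _++_; length; reverse)
import Data.List.Properties as LP
open import Data.List.Relation.Unary.All as All using (All; all?)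
open import Data.Product using (Σ; _,_; proj₁; proj₂; _×_)
open import Data.Sum using (_⊎_; inj₁; inj₂)
open import Data.Bool using (true; false; if_then_else_; T)
open import Data.Unit using (tt)
open import Data.Empty using (⊥; ⊥-elim)
open import Data.Maybe using (Maybe; nothing; just)
open import Relation.Nullary using (¬_; Dec; yes; no; does)
open import Relation.Binary.Definitions using (tri<; tri≈; tri>)
open import Relation.Binary.PropositionalEquality
open import Relation.Binary.Bundles using (Setoid)
open import Algebra.Bundles using (CommutativeRing)
import Relation.Binary.Reasoning.Setoid as SetoidReasoning
import Tactic.RingSolver as RS
import Tactic.RingSolver.Core.AlmostCommutativeRing as ACR

coeff : Poly → ℕ → ℤ
coeff []      _       = 0ℤ
coeff (a ∷ p) zero    = a
coeff (a ∷ p) (suc i) = coeff p i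

infix 4 _≈_
record _≈_ (p q : Poly) : Set where
  constructor mk≈
  field at : ∀ i → coeff p i ≡ coeff q i
open _≈_ public

≈-refl : ∀ {p} → p ≈ p
≈-refl = mk≈ λ _ → refl

≈-sym : ∀ {p q} → p ≈ q → q ≈ p
≈-sym e = mk≈ λ i → sym (at e i)

≈-trans : ∀ {p q r} → p ≈ q → q ≈ r → p ≈ r
≈-trans e f = mk≈ λ i → trans (at e i) (at f i)

≡⇒≈ : ∀ {p q} → p ≡ q → p ≈ q
≡⇒≈ refl = ≈-refl

Poly-setoid : Setoid _ _
Poly-setoid = record
  { Carrier = Poly ; _≈_ = _≈_
  ; isEquivalence = record { refl = ≈-refl ; sym = ≈-sym ; trans = ≈-trans } }

module ≈-Reasoning = SetoidReasoning Poly-setoid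

coeff-+ : ∀ p q i → coeff (p +ₚ q) i ≡ coeff p i +ℤ coeff q i
coeff-+ []      q       i       = sym (ℤP.+-identityˡ _)
coeff-+ (a ∷ p) []      i       = sym (ℤP.+-identityʳ _)
coeff-+ (a ∷ p) (b ∷ q) zero    = refl
coeff-+ (a ∷ p) (b ∷ q) (suc i) = coeff-+ p q i

coeff-neg : ∀ p i → coeff (negₚ p) i ≡ - coeff p i
coeff-neg []      i       = refl
coeff-neg (a ∷ p) zero    = refl
coeff-neg (a ∷ p) (suc i) = coeff-neg p i

coeff-scale : ∀ c p i → coeff (scaleₚ c p) i ≡ c *ℤ coeff p i
coeff-scale c []      i       = sym (ℤP.*-zeroʳ c)
coeff-scale c (a ∷ p) zero    = refl
coeff-scale c (a ∷ p) (suc i) = coeff-scale c p i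

coeff-- : ∀ p q i → coeff (p -ₚ q) i ≡ coeff p i -ℤ coeff q i
coeff-- p q i = trans (coeff-+ p (negₚ q) i) (cong (coeff p i +ℤ_) (coeff-neg q i))

coeff-*-∷ : ∀ a p q i → coeff ((a ∷ p) *ₚ q) i ≡ a *ℤ coeff q i +ℤ coeff (0ℤ ∷ (p *ₚ q)) i
coeff-*-∷ a p q i =
  trans (coeff-+ (scaleₚ a q) (0ℤ ∷ (p *ₚ q)) i) (cong (_+ℤ _) (coeff-scale a q i))

IsZero : Poly → Set
IsZero p = ∀ i → coeff p i ≡ 0ℤ

IsZero⇒All : ∀ p → IsZero p → All (_≡ 0ℤ) p
IsZero⇒All []      z = All.[]
IsZero⇒All (a ∷ p) z = z zero All.∷ IsZero⇒All p (λ i → z (suc i))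

All⇒IsZero : ∀ {p} → All (_≡ 0ℤ) p → IsZero p
All⇒IsZero All.[]      i       = refl
All⇒IsZero (e All.∷ _) zero    = e
All⇒IsZero (_ All.∷ a) (suc i) = All⇒IsZero a i

≈⇒≈ₚ : ∀ {p q} → p ≈ q → p ≈ₚ q
≈⇒≈ₚ {p} {q} e = IsZero⇒All (p -ₚ q) λ i →
  trans (coeff-- p q i) (trans (cong (_-ℤ coeff q i) (at e i)) (ℤP.+-inverseʳ (coeff q i)))

IsZero-*ˡ : ∀ p q → IsZero p → IsZero (p *ₚ q)
IsZero-*ˡ []      q z i = refl
IsZero-*ˡ (a ∷ p) q z i = trans (coeff-*-∷ a p q i)
  (cong₂ _+ℤ_ (cong (_*ℤ coeff q i) (z zero)) (shifted i))
  where
  shifted : ∀ i → coeff (0ℤ ∷ (p *ₚ q)) i ≡ 0ℤ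
  shifted zero    = refl
  shifted (suc i) = IsZero-*ˡ p q (λ j → z (suc j)) i

∷-cong : ∀ {a b p q} → a ≡ b → p ≈ q → (a ∷ p) ≈ (b ∷ q)
∷-cong e f = mk≈ λ { zero → e ; (suc i) → at f i }

+-cong : ∀ {p p' q q'} → p ≈ p' → q ≈ q' → p +ₚ q ≈ p' +ₚ q'
+-cong {p} {p'} {q} {q'} e f = mk≈ λ i →
  trans (coeff-+ p q i) (trans (cong₂ _+ℤ_ (at e i) (at f i)) (sym (coeff-+ p' q' i)))

neg-cong : ∀ {p p'} → p ≈ p' → negₚ p ≈ negₚ p'
neg-cong {p} {p'} e = mk≈ λ i →
  trans (coeff-neg p i) (trans (cong -_ (at e i)) (sym (coeff-neg p' i)))

+ₚ-comm : ∀ p q → p +ₚ q ≈ q +ₚ p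
+ₚ-comm p q = mk≈ λ i →
  trans (coeff-+ p q i) (trans (ℤP.+-comm (coeff p i) _) (sym (coeff-+ q p i)))

+ₚ-assoc : ∀ p q r → (p +ₚ q) +ₚ r ≈ p +ₚ (q +ₚ r)
+ₚ-assoc p q r = mk≈ λ i → begin
  coeff ((p +ₚ q) +ₚ r) i                 ≡⟨ coeff-+ (p +ₚ q) r i ⟩
  coeff (p +ₚ q) i +ℤ coeff r i           ≡⟨ cong (_+ℤ coeff r i) (coeff-+ p q i) ⟩
  (coeff p i +ℤ coeff q i) +ℤ coeff r i   ≡⟨ ℤP.+-assoc (coeff p i) _ _ ⟩
  coeff p i +ℤ (coeff q i +ℤ coeff r i)   ≡⟨ cong (coeff p i +ℤ_) (sym (coeff-+ q r i)) ⟩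
  coeff p i +ℤ coeff (q +ₚ r) i           ≡⟨ sym (coeff-+ p (q +ₚ r) i) ⟩
  coeff (p +ₚ (q +ₚ r)) i                 ∎
  where open ≡-Reasoning

+ₚ-identityʳ : ∀ p → p +ₚ [] ≈ p
+ₚ-identityʳ p = mk≈ λ i → trans (coeff-+ p [] i) (ℤP.+-identityʳ _)

+ₚ-inverseˡ : ∀ p → negₚ p +ₚ p ≈ []
+ₚ-inverseˡ p = mk≈ λ i → trans (coeff-+ (negₚ p) p i)
  (trans (cong (_+ℤ coeff p i) (coeff-neg p i)) (ℤP.+-inverseˡ (coeff p i)))

+ₚ-inverseʳ : ∀ p → p +ₚ negₚ p ≈ []
+ₚ-inverseʳ p = ≈-trans (+ₚ-comm p (negₚ p)) (+ₚ-inverseˡ p)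

+ₚ-interchange : ∀ p p' q q' → (p +ₚ p') +ₚ (q +ₚ q') ≈ (p +ₚ q) +ₚ (p' +ₚ q')
+ₚ-interchange p p' q q' = mk≈ λ i → begin
  coeff ((p +ₚ p') +ₚ (q +ₚ q')) i
    ≡⟨ trans (coeff-+ (p +ₚ p') _ i) (cong₂ _+ℤ_ (coeff-+ p p' i) (coeff-+ q q' i)) ⟩
  (coeff p i +ℤ coeff p' i) +ℤ (coeff q i +ℤ coeff q' i)
    ≡⟨ ℤ+.interchange (coeff p i) _ _ _ ⟩
  (coeff p i +ℤ coeff q i) +ℤ (coeff p' i +ℤ coeff q' i)
    ≡⟨ sym (trans (coeff-+ (p +ₚ q) _ i) (cong₂ _+ℤ_ (coeff-+ p q i) (coeff-+ p' q' i))) ⟩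
  coeff ((p +ₚ q) +ₚ (p' +ₚ q')) i ∎
  where open ≡-Reasoning

scale-distrib : ∀ c p q → scaleₚ c (p +ₚ q) ≈ scaleₚ c p +ₚ scaleₚ c q
scale-distrib c p q = mk≈ λ i → begin
  coeff (scaleₚ c (p +ₚ q)) i                   ≡⟨ coeff-scale c (p +ₚ q) i ⟩
  c *ℤ coeff (p +ₚ q) i                         ≡⟨ cong (c *ℤ_) (coeff-+ p q i) ⟩
  c *ℤ (coeff p i +ℤ coeff q i)                 ≡⟨ ℤP.*-distribˡ-+ c _ _ ⟩
  c *ℤ coeff p i +ℤ c *ℤ coeff q i              ≡⟨ sym (cong₂ _+ℤ_ (coeff-scale c p i) (coeff-scale c q i)) ⟩
  coeff (scaleₚ c p) i +ℤ coeff (scaleₚ c q) i  ≡⟨ sym (coeff-+ (scaleₚ c p) _ i) ⟩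
  coeff (scaleₚ c p +ₚ scaleₚ c q) i            ∎
  where open ≡-Reasoning

scale-+ : ∀ c d p → scaleₚ (c +ℤ d) p ≈ scaleₚ c p +ₚ scaleₚ d p
scale-+ c d p = mk≈ λ i → trans (coeff-scale (c +ℤ d) p i)
  (trans (ℤP.*-distribʳ-+ (coeff p i) c d)
  (sym (trans (coeff-+ (scaleₚ c p) _ i) (cong₂ _+ℤ_ (coeff-scale c p i) (coeff-scale d p i)))))

scale-scale : ∀ c d p → scaleₚ c (scaleₚ d p) ≈ scaleₚ (c *ℤ d) p
scale-scale c d p = mk≈ λ i → trans (coeff-scale c (scaleₚ d p) i)
  (trans (cong (c *ℤ_) (coeff-scale d p i))
  (trans (sym (ℤP.*-assoc c d _)) (sym (coeff-scale (c *ℤ d) p i))))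

scale-1 : ∀ p → scaleₚ 1ℤ p ≈ p
scale-1 p = mk≈ λ i → trans (coeff-scale 1ℤ p i) (ℤP.*-identityˡ (coeff p i))

scale-0 : ∀ p → scaleₚ 0ℤ p ≈ []
scale-0 p = mk≈ λ i → trans (coeff-scale 0ℤ p i) (ℤP.*-zeroˡ (coeff p i))

shift : Poly → Poly
shift p = 0ℤ ∷ p

shift-cong : ∀ {p q} → p ≈ q → shift p ≈ shift q
shift-cong = ∷-cong refl

shift-[] : shift [] ≈ []
shift-[] = mk≈ λ { zero → refl ; (suc i) → refl }

shift-*ˡ : ∀ p q → shift p *ₚ q ≈ shift (p *ₚ q)
shift-*ˡ p q = +-cong (scale-0 q) ≈-refl

*-zeroʳ : ∀ p → p *ₚ [] ≈ []
*-zeroʳ p = mk≈ (go p)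
  where
  go : ∀ p → IsZero (p *ₚ [])
  go []      i       = refl
  go (a ∷ p) zero    = refl
  go (a ∷ p) (suc i) = go p i

*-congˡ : ∀ {p p'} q → p ≈ p' → p *ₚ q ≈ p' *ₚ q
*-congˡ {[]}    {[]}     q e = ≈-refl
*-congˡ {[]}    {a ∷ p'} q e = mk≈ λ i → sym (IsZero-*ˡ (a ∷ p') q (λ j → sym (at e j)) i)
*-congˡ {a ∷ p} {[]}     q e = mk≈ (IsZero-*ˡ (a ∷ p) q (at e))
*-congˡ {a ∷ p} {b ∷ p'} q e = mk≈ λ i → trans (coeff-*-∷ a p q i)
  (trans (cong₂ _+ℤ_ (cong (_*ℤ coeff q i) (at e zero))
                     (at (shift-cong (*-congˡ {p} {p'} q (mk≈ λ j → at e (suc j)))) i))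
  (sym (coeff-*-∷ b p' q i)))

*-∷ʳ : ∀ p b q → p *ₚ (b ∷ q) ≈ scaleₚ b p +ₚ shift (p *ₚ q)
*-∷ʳ []      b q = mk≈ λ { zero → refl ; (suc i) → refl }
*-∷ʳ (a ∷ p) b q = ∷-cong (cong (_+ℤ 0ℤ) (ℤP.*-comm a b))
  (≈-trans (+-cong (≈-refl {scaleₚ a q}) (*-∷ʳ p b q)) (swap (scaleₚ a q) (scaleₚ b p) _))
  where
  swap : ∀ x y z → x +ₚ (y +ₚ z) ≈ y +ₚ (x +ₚ z)
  swap x y z = ≈-trans (≈-sym (+ₚ-assoc x y z))
    (≈-trans (+-cong (+ₚ-comm x y) ≈-refl) (+ₚ-assoc y x z))

*-comm : ∀ p q → p *ₚ q ≈ q *ₚ p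
*-comm []      q = ≈-sym (*-zeroʳ q)
*-comm (a ∷ p) q = ≈-trans (+-cong ≈-refl (shift-cong (*-comm p q))) (≈-sym (*-∷ʳ q a p))

*-congʳ : ∀ p {q q'} → q ≈ q' → p *ₚ q ≈ p *ₚ q'
*-congʳ p {q} {q'} e = ≈-trans (*-comm p q) (≈-trans (*-congˡ p e) (*-comm q' p))

*-cong : ∀ {p p' q q'} → p ≈ p' → q ≈ q' → p *ₚ q ≈ p' *ₚ q'
*-cong {p} {p'} {q} {q'} e f = ≈-trans (*-congˡ q e) (*-congʳ p' f)

*-distribʳ : ∀ p p' q → (p +ₚ p') *ₚ q ≈ p *ₚ q +ₚ p' *ₚ q
*-distribʳ []      p'       q = ≈-refl
*-distribʳ (a ∷ p) []       q = ≈-sym (+ₚ-identityʳ _)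
*-distribʳ (a ∷ p) (b ∷ p') q =
  ≈-trans (+-cong (scale-+ a b q) (shift-cong (*-distribʳ p p' q)))
          (+ₚ-interchange (scaleₚ a q) (scaleₚ b q) (shift (p *ₚ q)) (shift (p' *ₚ q)))

*-distribˡ : ∀ p q q' → p *ₚ (q +ₚ q') ≈ p *ₚ q +ₚ p *ₚ q'
*-distribˡ p q q' = ≈-trans (*-comm p _)
  (≈-trans (*-distribʳ q q' p) (+-cong (*-comm q p) (*-comm q' p)))

scale-*ˡ : ∀ c p q → scaleₚ c (p *ₚ q) ≈ scaleₚ c p *ₚ q
scale-*ˡ c []      q = ≈-refl
scale-*ˡ c (a ∷ p) q =
  ≈-trans (scale-distrib c (scaleₚ a q) (shift (p *ₚ q)))
          (+-cong (scale-scale c a q) (∷-cong (ℤP.*-zeroʳ c) (scale-*ˡ c p q)))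

*-assoc : ∀ p q r → (p *ₚ q) *ₚ r ≈ p *ₚ (q *ₚ r)
*-assoc []      q r = ≈-refl
*-assoc (a ∷ p) q r = ≈-trans (*-distribʳ (scaleₚ a q) _ r)
  (+-cong (≈-sym (scale-*ˡ a q r)) (≈-trans (shift-*ˡ (p *ₚ q) r) (shift-cong (*-assoc p q r))))

𝟙 : Poly
𝟙 = constₚ 1ℤ

*-identityˡ : ∀ p → 𝟙 *ₚ p ≈ p
*-identityˡ p = ≈-trans (+-cong (scale-1 p) shift-[]) (+ₚ-identityʳ p)

*-identityʳ : ∀ p → p *ₚ 𝟙 ≈ p
*-identityʳ p = ≈-trans (*-comm p _) (*-identityˡ p)

Poly-commutativeRing : CommutativeRing _ _
Poly-commutativeRing = record
  { Carrier = Poly ; _≈_ = _≈_ ; _+_ = _+ₚ_ ; _*_ = _*ₚ_ ; -_ = negₚ ; 0# = [] ; 1# = 𝟙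
  ; isCommutativeRing = record
    { isRing = record
      { +-isAbelianGroup = record
        { isGroup = record
          { isMonoid = record
            { isSemigroup = record
              { isMagma = record { isEquivalence = Setoid.isEquivalence Poly-setoid ; ∙-cong = +-cong }
              ; assoc = +ₚ-assoc }
            ; identity = (λ _ → ≈-refl) , +ₚ-identityʳ }
          ; inverse = +ₚ-inverseˡ , +ₚ-inverseʳ
          ; ⁻¹-cong = neg-cong }
        ; comm = +ₚ-comm }
      ; *-cong = *-cong
      ; *-assoc = *-assoc
      ; *-identity = *-identityˡ , *-identityʳ
      ; distrib = *-distribˡ , (λ x y z → *-distribʳ y z x) }
    ; *-comm = *-comm } }

Poly-ring : ACR.AlmostCommutativeRing _ _
Poly-ring = ACR.fromCommutativeRing Poly-commutativeRing isZero?
  where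
  isZero? : ∀ x → Maybe ([] ≈ x)
  isZero? x with all? (ℤ._≟ 0ℤ) x
  ... | yes a = just (≈-sym (mk≈ (All⇒IsZero a)))
  ... | no _  = nothing

open RS using (solve)

-- 'normalize' (defined via reversal) computed by a right fold: drop a zero only at the top.
consTrim : ℤ → Poly → Poly
consTrim a []      = if isZeroℤ a then [] else a ∷ []
consTrim a (b ∷ r) = a ∷ b ∷ r

trim : Poly → Poly
trim []      = []
trim (a ∷ p) = consTrim a (trim p)

private
  dropZerosThen : List ℤ → List ℤ → List ℤ
  dropZerosThen []      m = dropZeros m
  dropZerosThen (x ∷ r) m = x ∷ (r ++ m)

  dropZeros-++ : ∀ l m → dropZeros (l ++ m) ≡ dropZerosThen (dropZeros l) m
  dropZeros-++ []      m = refl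
  dropZeros-++ (b ∷ l) m with isZeroℤ b
  ... | true  = dropZeros-++ l m
  ... | false = refl

  consTrim-reverse : ∀ a r → consTrim a (reverse r) ≡ reverse (dropZerosThen r (a ∷ []))
  consTrim-reverse a [] with isZeroℤ a
  ... | true  = refl
  ... | false = refl
  consTrim-reverse a (x ∷ r) with reverse (x ∷ r) in eq
  ... | []     with () ← trans (sym (LP.length-reverse (x ∷ r))) (cong length eq)
  ... | b ∷ r' = sym (trans (LP.reverse-++ (x ∷ r) (a ∷ [])) (cong (a ∷_) eq))

-- 'normalize' agrees with 'trim', which visibly preserves _≈_.
normalize≡trim : ∀ p → normalize p ≡ trim p
normalize≡trim []      = refl
normalize≡trim (a ∷ p) = begin
  reverse (dropZeros (reverse (a ∷ p)))              ≡⟨ cong (λ z → reverse (dropZeros z)) (LP.unfold-reverse a p) ⟩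
  reverse (dropZeros (reverse p ++ (a ∷ [])))        ≡⟨ cong reverse (dropZeros-++ (reverse p) (a ∷ [])) ⟩
  reverse (dropZerosThen (dropZeros (reverse p)) (a ∷ [])) ≡⟨ sym (consTrim-reverse a (dropZeros (reverse p))) ⟩
  consTrim a (normalize p)                           ≡⟨ cong (consTrim a) (normalize≡trim p) ⟩
  consTrim a (trim p)                                ∎
  where open ≡-Reasoning

isZeroℤ-sound : ∀ a → isZeroℤ a ≡ true → a ≡ 0ℤ
isZeroℤ-sound (+ zero) _ = refl

consTrim≈ : ∀ a r → consTrim a r ≈ (a ∷ r)
consTrim≈ a [] with isZeroℤ a in eq
... | true  = mk≈ λ { zero → sym (isZeroℤ-sound a eq) ; (suc i) → refl }
... | false = ≈-refl
consTrim≈ a (b ∷ r) = ≈-refl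

trim≈ : ∀ p → trim p ≈ p
trim≈ []      = ≈-refl
trim≈ (a ∷ p) = ≈-trans (consTrim≈ a (trim p)) (∷-cong refl (trim≈ p))

normalize≈ : ∀ p → normalize p ≈ p
normalize≈ p = subst (_≈ p) (sym (normalize≡trim p)) (trim≈ p)

DegBelow : ℕ → Poly → Set
DegBelow n p = ∀ i → n ≤ i → coeff p i ≡ 0ℤ

DegBelow-≈ : ∀ {n p q} → p ≈ q → DegBelow n p → DegBelow n q
DegBelow-≈ e s i le = trans (sym (at e i)) (s i le)

DegBelow-mono : ∀ {m n p} → m ≤ n → DegBelow m p → DegBelow n p
DegBelow-mono le s i le' = s i (ℕP.≤-trans le le')

DegBelow-length : ∀ p → DegBelow (length p) p
DegBelow-length []      i       _         = refl
DegBelow-length (a ∷ p) (suc i) (s≤s le) = DegBelow-length p i le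

DegBelow-scale : ∀ {n} c p → DegBelow n p → DegBelow n (scaleₚ c p)
DegBelow-scale c p s i le = trans (coeff-scale c p i) (trans (cong (c *ℤ_) (s i le)) (ℤP.*-zeroʳ c))

DegBelow-- : ∀ {n} p q → DegBelow n p → DegBelow n q → DegBelow n (p -ₚ q)
DegBelow-- p q s t i le = trans (coeff-- p q i) (cong₂ _-ℤ_ (s i le) (t i le))

trim-IsZero : ∀ p → IsZero p → trim p ≡ []
trim-IsZero []      z = refl
trim-IsZero (a ∷ p) z rewrite trim-IsZero p (λ i → z (suc i)) | z zero = refl

trim-length≤ : ∀ n p → DegBelow n p → length (trim p) ≤ n
trim-length≤ n       []      s = z≤n
trim-length≤ zero    (a ∷ p) s rewrite trim-IsZero (a ∷ p) (λ i → s i z≤n) = z≤n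
trim-length≤ (suc n) (a ∷ p) s =
  ℕP.≤-trans (consTrim-length a (trim p)) (s≤s (trim-length≤ n p (λ i le → s (suc i) (s≤s le))))
  where
  consTrim-length : ∀ a r → length (consTrim a r) ≤ suc (length r)
  consTrim-length a [] with isZeroℤ a
  ... | true  = z≤n
  ... | false = ℕP.≤-refl
  consTrim-length a (b ∷ r) = ℕP.≤-refl

-- Normalising never lengthens a list; this bounds the fuel of long division.
normalize-length< : ∀ p → length (normalize p) < suc (length p)
normalize-length< p rewrite normalize≡trim p = s≤s (trim-length≤ (length p) p (DegBelow-length p))

lastCoeff≡ : ∀ l → lastCoeff l ≡ coeff l (length l ∸ 1)
lastCoeff≡ []          = refl
lastCoeff≡ (a ∷ [])    = refl
lastCoeff≡ (a ∷ b ∷ l) = lastCoeff≡ (b ∷ l)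

record Monic (e : ℕ) (p : Poly) : Set where
  constructor monicOf
  field
    bounded : DegBelow (suc e) p
    leading : coeff p e ≡ 1ℤ
open Monic

Monic-≈ : ∀ {e p q} → p ≈ q → Monic e p → Monic e q
Monic-≈ eq (monicOf s c) = monicOf (DegBelow-≈ eq s) (trans (sym (at eq _)) c)

1≢0 : 1ℤ ≢ 0ℤ
1≢0 ()

Monic-length : ∀ {e d} → Monic e d → length (normalize d) ≡ suc e
Monic-length {e} {d} (monicOf s c) rewrite normalize≡trim d =
  ℕP.≤-antisym (trim-length≤ (suc e) d s) (nonzero e (λ z → 1≢0 (trans (sym c) z)))
  where
  nonzero : ∀ i → coeff d i ≢ 0ℤ → i < length (trim d)
  nonzero i nz with ℕP.<-≤-connex i (length (trim d))
  ... | inj₁ lt = lt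
  ... | inj₂ ge = ⊥-elim (nz (DegBelow-≈ (trim≈ d) (DegBelow-length (trim d)) i ge))

*-top : ∀ k e X d → DegBelow (suc k) X → DegBelow (suc e) d →
        DegBelow (suc (k + e)) (X *ₚ d) × coeff (X *ₚ d) (k + e) ≡ coeff X k *ℤ coeff d e
*-top k e [] d _ _ = (λ _ _ → refl) , refl
*-top zero e (a ∷ X) d sX sd = deg , top
  where
  rest : IsZero (shift (X *ₚ d))
  rest zero    = refl
  rest (suc i) = IsZero-*ˡ X d (λ i → sX (suc i) (s≤s z≤n)) i
  deg : DegBelow (suc e) ((a ∷ X) *ₚ d)
  deg i le = trans (coeff-*-∷ a X d i)
    (trans (cong₂ _+ℤ_ (cong (a *ℤ_) (sd i le)) (rest i)) (cong (_+ℤ 0ℤ) (ℤP.*-zeroʳ a)))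
  top : coeff ((a ∷ X) *ₚ d) e ≡ a *ℤ coeff d e
  top = trans (coeff-*-∷ a X d e) (trans (cong (a *ℤ coeff d e +ℤ_) (rest e)) (ℤP.+-identityʳ _))
*-top (suc k) e (a ∷ X) d sX sd = deg , top
  where
  ih : DegBelow (suc (k + e)) (X *ₚ d) × coeff (X *ₚ d) (k + e) ≡ coeff X k *ℤ coeff d e
  ih = *-top k e X d (λ i le → sX (suc i) (s≤s le)) sd
  low : ∀ i → k + e ≤ i → coeff d (suc i) ≡ 0ℤ
  low i le = sd (suc i) (s≤s (ℕP.≤-trans (ℕP.m≤n+m e k) le))
  deg : DegBelow (suc (suc k + e)) ((a ∷ X) *ₚ d)
  deg (suc i) (s≤s le) = trans (coeff-*-∷ a X d (suc i))
    (trans (cong₂ _+ℤ_ (cong (a *ℤ_) (low i (ℕP.≤-trans (ℕP.n≤1+n _) le))) (proj₁ ih i le))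
           (cong (_+ℤ 0ℤ) (ℤP.*-zeroʳ a)))
  top : coeff ((a ∷ X) *ₚ d) (suc (k + e)) ≡ coeff X k *ℤ coeff d e
  top = trans (coeff-*-∷ a X d (suc (k + e)))
    (trans (cong₂ _+ℤ_ (cong (a *ℤ_) (low (k + e) ℕP.≤-refl)) (proj₂ ih))
    (trans (cong (_+ℤ _) (ℤP.*-zeroʳ a)) (ℤP.+-identityˡ _)))

Monic-* : ∀ {e₁ e₂} p q → Monic e₁ p → Monic e₂ q → Monic (e₁ + e₂) (p *ₚ q)
Monic-* {e₁} {e₂} p q (monicOf s₁ c₁) (monicOf s₂ c₂) =
  monicOf (proj₁ top) (trans (proj₂ top) (cong₂ _*ℤ_ c₁ c₂))
  where
  top : DegBelow (suc (e₁ + e₂)) (p *ₚ q) × coeff (p *ₚ q) (e₁ + e₂) ≡ coeff p e₁ *ℤ coeff q e₂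
  top = *-top e₁ e₂ p q s₁ s₂

Xpow-monic : ∀ m → Monic m (Xpow m)
Xpow-monic zero    = monicOf (λ { zero () ; (suc i) _ → refl }) refl
Xpow-monic (suc m) = monicOf (λ { zero () ; (suc i) (s≤s le) → bounded (Xpow-monic m) i le }) (leading (Xpow-monic m))

𝟙-monic : Monic 0 𝟙
𝟙-monic = monicOf (λ { zero () ; (suc i) _ → refl }) refl

monic-cancel-zero : ∀ {e M} X → Monic e M → DegBelow e (X *ₚ M) → IsZero X
monic-cancel-zero {e} {M} X (monicOf sM cM) h = go (length X) (DegBelow-length X)
  where
  go : ∀ k → DegBelow k X → IsZero X
  go zero    s i = s i z≤n
  go (suc k) s = go k lower
    where
    top : coeff X k ≡ 0ℤ
    top = begin
      coeff X k                  ≡⟨ sym (ℤP.*-identityʳ _) ⟩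
      coeff X k *ℤ 1ℤ            ≡⟨ cong (coeff X k *ℤ_) (sym cM) ⟩
      coeff X k *ℤ coeff M e     ≡⟨ sym (proj₂ (*-top k e X M s sM)) ⟩
      coeff (X *ₚ M) (k + e)     ≡⟨ h (k + e) (ℕP.m≤n+m e k) ⟩
      0ℤ                         ∎
      where open ≡-Reasoning
    lower : DegBelow k X
    lower i le with ℕP.m≤n⇒m<n∨m≡n le
    ... | inj₁ lt   = s i lt
    ... | inj₂ refl = top

difference-zero : ∀ p q → IsZero (p -ₚ q) → p ≈ q
difference-zero p q z = mk≈ λ i → ℤP.i-j≡0⇒i≡j _ _ (trans (sym (coeff-- p q i)) (z i))

monic-cancel : ∀ {e M} A B → Monic e M → A *ₚ M ≈ B *ₚ M → A ≈ B
monic-cancel {M = M} A B mM h =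
  difference-zero A B (monic-cancel-zero (A -ₚ B) mM (λ i _ → at vanish i))
  where
  vanish : (A -ₚ B) *ₚ M ≈ []
  vanish = ≈-trans (lemma A B M) (≈-trans (+-cong h ≈-refl) (+ₚ-inverseʳ (B *ₚ M)))
    where
    lemma : ∀ A B M → (A +ₚ negₚ B) *ₚ M ≈ A *ₚ M +ₚ negₚ (B *ₚ M)
    lemma A B M = solve (A ∷ B ∷ M ∷ []) Poly-ring

-- Subtracting c·q^m·D from P, where c is the coefficient of q^(m+e) in P and D is monic of
-- degree e, kills that coefficient and so lowers the degree bound of P by one.
leading-step : ∀ m e P D → Monic e D → DegBelow (suc (m + e)) P →
  DegBelow (m + e) (P -ₚ scaleₚ (coeff P (m + e)) (Xpow m) *ₚ D)
leading-step m e P D (monicOf sD cD) sP = deg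
  where
  c : ℤ
  c = coeff P (m + e)
  t : Poly
  t = scaleₚ c (Xpow m)
  top = *-top m e t D (DegBelow-scale c (Xpow m) (bounded (Xpow-monic m))) sD
  t-top : coeff t m ≡ c
  t-top = trans (coeff-scale c (Xpow m) m) (trans (cong (c *ℤ_) (leading (Xpow-monic m))) (ℤP.*-identityʳ c))
  deg : DegBelow (m + e) (P -ₚ t *ₚ D)
  deg i le with ℕP.m≤n⇒m<n∨m≡n le
  ... | inj₁ lt   = DegBelow-- P (t *ₚ D) sP (proj₁ top) i lt
  ... | inj₂ refl = begin
    coeff (P -ₚ t *ₚ D) (m + e)    ≡⟨ coeff-- P (t *ₚ D) (m + e) ⟩
    c -ℤ coeff (t *ₚ D) (m + e)    ≡⟨ cong (c -ℤ_) (trans (proj₂ top) (cong₂ _*ℤ_ t-top cD)) ⟩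
    c -ℤ c *ℤ 1ℤ                   ≡⟨ cong (c -ℤ_) (ℤP.*-identityʳ c) ⟩
    c -ℤ c                         ≡⟨ ℤP.+-inverseʳ c ⟩
    0ℤ                             ∎
    where open ≡-Reasoning

private
  split-term : ∀ P t D → P ≈ (P +ₚ negₚ (t *ₚ D)) +ₚ t *ₚ D
  split-term P t D = solve (P ∷ t ∷ D ∷ []) Poly-ring

  add-term : ∀ Q D r t → (Q *ₚ D +ₚ r) +ₚ t *ₚ D ≈ (t +ₚ Q) *ₚ D +ₚ r
  add-term Q D r t = solve (Q ∷ D ∷ r ∷ t ∷ []) Poly-ring

-- The division loop stops exactly when the normalised dividend has degree below e.
short-length : ∀ {e d} L → Monic e d → (L <ᵇ length (normalize d)) ≡ true → L ≤ e
short-length L md eq = ℕP.≤-pred (subst (L <_) (Monic-length md) (ℕP.<ᵇ⇒< L _ (subst T (sym eq) tt)))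

long-length : ∀ {e d} L → Monic e d → (L <ᵇ length (normalize d)) ≡ false → L ≡ suc (L ∸ length (normalize d) + e)
long-length {e} {d} L md eq = begin
  L                        ≡⟨ sym (ℕP.m∸n+n≡m long) ⟩
  L ∸ suc e + suc e        ≡⟨ ℕP.+-suc _ e ⟩
  suc (L ∸ suc e + e)      ≡⟨ cong (λ z → suc (L ∸ z + e)) (sym (Monic-length md)) ⟩
  suc (L ∸ length (normalize d) + e) ∎
  where
  open ≡-Reasoning
  long : suc e ≤ L
  long with ℕP.<-≤-connex L (suc e)
  ... | inj₁ l = ⊥-elim (subst T eq (ℕP.<⇒<ᵇ (subst (L <_) (sym (Monic-length md)) l)))
  ... | inj₂ g = g

divFuel-correct : ∀ f p d {e} → Monic e d → length (normalize p) < f →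
  Σ Poly λ r → (p ≈ divFuel f p d *ₚ d +ₚ r) × DegBelow e r
divFuel-correct (suc f) p d {e} md lt with length (normalize p) <ᵇ length (normalize d) in eq
... | true = p , ≈-refl , DegBelow-mono {p = p} (short-length (length (normalize p)) md eq)
                                         (DegBelow-≈ (normalize≈ p) (DegBelow-length (normalize p)))
... | false = r , equation , proj₂ (proj₂ ih)
  where
  P : Poly
  P = normalize p
  D : Poly
  D = normalize d
  L : ℕ
  L = length P
  m : ℕ
  m = L ∸ length D
  t : Poly
  t = scaleₚ (lastCoeff P) (Xpow m)
  mD : Monic e D
  mD = Monic-≈ (≈-sym (normalize≈ d)) md
  L≡ : L ≡ suc (m + e)
  L≡ = long-length L md eq
  lower : DegBelow (m + e) (P -ₚ t *ₚ D)
  lower = subst (λ c → DegBelow (m + e) (P -ₚ scaleₚ c (Xpow m) *ₚ D))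
    (sym (trans (lastCoeff≡ P) (cong (λ z → coeff P (z ∸ 1)) L≡)))
    (leading-step m e P D mD (subst (λ n → DegBelow n P) L≡ (DegBelow-length P)))
  fuel : length (normalize (P -ₚ t *ₚ D)) < f
  fuel = ℕP.≤-<-trans (subst (_≤ m + e) (sym (cong length (normalize≡trim (P -ₚ t *ₚ D))))
                             (trim-length≤ (m + e) (P -ₚ t *ₚ D) lower))
                      (subst (_≤ f) L≡ (ℕP.≤-pred lt))
  ih : Σ Poly λ r → (P -ₚ t *ₚ D ≈ divFuel f (P -ₚ t *ₚ D) D *ₚ D +ₚ r) × DegBelow e r
  ih = divFuel-correct f (P -ₚ t *ₚ D) D mD fuel
  r : Poly
  r = proj₁ ih
  Q : Poly
  Q = divFuel f (P -ₚ t *ₚ D) D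
  equation : p ≈ (t +ₚ Q) *ₚ d +ₚ r
  equation = begin
    p                              ≈⟨ ≈-sym (normalize≈ p) ⟩
    P                              ≈⟨ split-term P t D ⟩
    (P -ₚ t *ₚ D) +ₚ t *ₚ D        ≈⟨ +-cong (proj₁ (proj₂ ih)) ≈-refl ⟩
    (Q *ₚ D +ₚ r) +ₚ t *ₚ D        ≈⟨ add-term Q D r t ⟩
    (t +ₚ Q) *ₚ D +ₚ r             ≈⟨ +-cong (*-congʳ (t +ₚ Q) (normalize≈ d)) ≈-refl ⟩
    (t +ₚ Q) *ₚ d +ₚ r             ∎
    where open ≈-Reasoning

divMonic-correct : ∀ p d {e} → Monic e d → Σ Poly λ r → (p ≈ divMonic p d *ₚ d +ₚ r) × DegBelow e r
divMonic-correct p d md = divFuel-correct (suc (length p)) p d md (normalize-length< p)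

divMonic-exact : ∀ {e} p d Q → Monic e d → p ≈ Q *ₚ d → divMonic p d ≈ Q
divMonic-exact {e} p d Q md h = ≈-sym (difference-zero Q (divMonic p d)
  (monic-cancel-zero (Q -ₚ divMonic p d) md (DegBelow-≈ (≈-sym remainder) (proj₂ (proj₂ div)))))
  where
  div : Σ Poly λ r → (p ≈ divMonic p d *ₚ d +ₚ r) × DegBelow e r
  div = divMonic-correct p d md
  remainder : (Q -ₚ divMonic p d) *ₚ d ≈ proj₁ div
  remainder = lemma Q (divMonic p d) d (proj₁ div) (≈-trans (≈-sym h) (proj₁ (proj₂ div)))
    where
    lemma : ∀ Q Q₀ d r → Q *ₚ d ≈ Q₀ *ₚ d +ₚ r → (Q +ₚ negₚ Q₀) *ₚ d ≈ r
    lemma Q Q₀ d r e = ≈-trans (*-distribʳ Q (negₚ Q₀) d) (≈-trans (+-cong e ≈-refl)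
      (solve (Q₀ ∷ d ∷ r ∷ []) Poly-ring))

natₚ : ℕ → Poly
natₚ m = constₚ (+ m)

scale≈const* : ∀ z p → scaleₚ z p ≈ constₚ z *ₚ p
scale≈const* z p = ≈-sym (≈-trans (+-cong ≈-refl shift-[]) (+ₚ-identityʳ _))

const-* : ∀ x y → constₚ (x *ℤ y) ≈ constₚ x *ₚ constₚ y
const-* x y = ∷-cong (sym (ℤP.+-identityʳ _)) ≈-refl

const-0 : constₚ 0ℤ ≈ []
const-0 = mk≈ λ { zero → refl ; (suc i) → refl }

natₚ-* : ∀ a b → natₚ a *ₚ natₚ b ≈ natₚ (a * b)
natₚ-* a b = ≈-trans (≈-sym (const-* (+ a) (+ b))) (∷-cong (sym (ℤP.pos-* a b)) ≈-refl)

infix 4 _∣ₚ_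
record _∣ₚ_ (M p : Poly) : Set where
  constructor dividesₚ
  field
    quotient : Poly
    equation : p ≈ quotient *ₚ M
open _∣ₚ_ public

∣ₚ-respʳ : ∀ {M p q} → p ≈ q → M ∣ₚ p → M ∣ₚ q
∣ₚ-respʳ e (dividesₚ H h) = dividesₚ H (≈-trans (≈-sym e) h)

∣ₚ-respˡ : ∀ {M M' p} → M ≈ M' → M ∣ₚ p → M' ∣ₚ p
∣ₚ-respˡ e (dividesₚ H h) = dividesₚ H (≈-trans h (*-congʳ H e))

∣ₚ-refl : ∀ M → M ∣ₚ M
∣ₚ-refl M = dividesₚ 𝟙 (≈-sym (*-identityˡ M))

∣ₚ-zero : ∀ {M p} → p ≈ [] → M ∣ₚ p
∣ₚ-zero e = dividesₚ [] e

∣ₚ-+ : ∀ {M p q} → M ∣ₚ p → M ∣ₚ q → M ∣ₚ p +ₚ q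
∣ₚ-+ {M} (dividesₚ H h) (dividesₚ H' h') =
  dividesₚ (H +ₚ H') (≈-trans (+-cong h h') (≈-sym (*-distribʳ H H' M)))

∣ₚ-neg : ∀ {M p} → M ∣ₚ p → M ∣ₚ negₚ p
∣ₚ-neg {M} (dividesₚ H h) = dividesₚ (negₚ H) (≈-trans (neg-cong h) (lemma H M))
  where
  lemma : ∀ H M → negₚ (H *ₚ M) ≈ negₚ H *ₚ M
  lemma H M = solve (H ∷ M ∷ []) Poly-ring

∣ₚ-*ˡ : ∀ {M p} A → M ∣ₚ p → M ∣ₚ A *ₚ p
∣ₚ-*ˡ {M} A (dividesₚ H h) = dividesₚ (A *ₚ H) (≈-trans (*-congʳ A h) (≈-sym (*-assoc A H M)))

∣ₚ-*ʳ : ∀ {M p} A → M ∣ₚ p → M ∣ₚ p *ₚ A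
∣ₚ-*ʳ {M} {p} A d = ∣ₚ-respʳ (*-comm A p) (∣ₚ-*ˡ A d)

∣ₚ-trans : ∀ {A B p} → A ∣ₚ B → B ∣ₚ p → A ∣ₚ p
∣ₚ-trans {A} (dividesₚ H h) (dividesₚ H' h') =
  dividesₚ (H' *ₚ H) (≈-trans h' (≈-trans (*-congʳ H' h) (≈-sym (*-assoc H' H A))))

∣ₚ-* : ∀ {A B p q} → A ∣ₚ p → B ∣ₚ q → A *ₚ B ∣ₚ p *ₚ q
∣ₚ-* {A} {B} (dividesₚ H h) (dividesₚ H' h') =
  dividesₚ (H *ₚ H') (≈-trans (*-cong h h') (lemma H A H' B))
  where
  lemma : ∀ H A H' B → (H *ₚ A) *ₚ (H' *ₚ B) ≈ (H *ₚ H') *ₚ (A *ₚ B)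
  lemma H A H' B = solve (H ∷ A ∷ H' ∷ B ∷ []) Poly-ring

infix 4 _≡[_]_
record _≡[_]_ (x M y : Poly) : Set where
  constructor congruent
  field difference : M ∣ₚ x -ₚ y
open _≡[_]_ public

≈⇒≡ : ∀ {M x y} → x ≈ y → x ≡[ M ] y
≈⇒≡ {y = y} e = congruent (∣ₚ-zero (≈-trans (+-cong e ≈-refl) (+ₚ-inverseʳ y)))

≡-refl : ∀ {M x} → x ≡[ M ] x
≡-refl = ≈⇒≡ ≈-refl

≡-sym : ∀ {M x y} → x ≡[ M ] y → y ≡[ M ] x
≡-sym {x = x} {y} (congruent d) = congruent (∣ₚ-respʳ (lemma x y) (∣ₚ-neg d))
  where
  lemma : ∀ x y → negₚ (x +ₚ negₚ y) ≈ y +ₚ negₚ x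
  lemma x y = solve (x ∷ y ∷ []) Poly-ring

≡-trans : ∀ {M x y z} → x ≡[ M ] y → y ≡[ M ] z → x ≡[ M ] z
≡-trans {x = x} {y} {z} (congruent d) (congruent d') = congruent (∣ₚ-respʳ (lemma x y z) (∣ₚ-+ d d'))
  where
  lemma : ∀ x y z → (x +ₚ negₚ y) +ₚ (y +ₚ negₚ z) ≈ x +ₚ negₚ z
  lemma x y z = solve (x ∷ y ∷ z ∷ []) Poly-ring

≡-+ : ∀ {M x y x' y'} → x ≡[ M ] x' → y ≡[ M ] y' → x +ₚ y ≡[ M ] x' +ₚ y'
≡-+ {x = x} {y} {x'} {y'} (congruent d) (congruent d') = congruent (∣ₚ-respʳ (lemma x y x' y') (∣ₚ-+ d d'))
  where
  lemma : ∀ x y x' y' → (x +ₚ negₚ x') +ₚ (y +ₚ negₚ y') ≈ (x +ₚ y) +ₚ negₚ (x' +ₚ y')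
  lemma x y x' y' = solve (x ∷ y ∷ x' ∷ y' ∷ []) Poly-ring

≡-* : ∀ {M x y x' y'} → x ≡[ M ] x' → y ≡[ M ] y' → x *ₚ y ≡[ M ] x' *ₚ y'
≡-* {x = x} {y} {x'} {y'} (congruent d) (congruent d') =
  congruent (∣ₚ-respʳ (lemma x y x' y') (∣ₚ-+ (∣ₚ-*ʳ y d) (∣ₚ-*ˡ x' d')))
  where
  lemma : ∀ x y x' y' → (x +ₚ negₚ x') *ₚ y +ₚ x' *ₚ (y +ₚ negₚ y') ≈ x *ₚ y +ₚ negₚ (x' *ₚ y')
  lemma x y x' y' = solve (x ∷ y ∷ x' ∷ y' ∷ []) Poly-ring

∣ₚ⇒≡0 : ∀ {M x} → M ∣ₚ x → x ≡[ M ] []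
∣ₚ⇒≡0 {x = x} d = congruent (∣ₚ-respʳ (≈-sym (+ₚ-identityʳ x)) d)

≡⇒CongMod : ∀ {M x y} → x ≡[ M ] y → CongMod x y M
≡⇒CongMod (congruent (dividesₚ H h)) = H , ≈⇒≈ₚ h

private
  expand-difference : ∀ c G H M → (G +ₚ negₚ (c *ₚ H)) *ₚ M ≈ G *ₚ M +ₚ negₚ (c *ₚ H *ₚ M)
  expand-difference c G H M = solve (c ∷ G ∷ H ∷ M ∷ []) Poly-ring

  cancel-quotient : ∀ c H M R → c *ₚ (H *ₚ M +ₚ R) +ₚ negₚ (c *ₚ H *ₚ M) ≈ c *ₚ R
  cancel-quotient c H M R = solve (c ∷ H ∷ M ∷ R ∷ []) Poly-ring

  positive-cancel : ∀ c {y} → + suc c *ℤ y ≡ 0ℤ → y ≡ 0ℤ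
  positive-cancel c e with ℤP.i*j≡0⇒i≡0∨j≡0 (+ suc c) e
  ... | inj₂ y≡0 = y≡0

∣ₚ-cancel-nat : ∀ {e M Q} c → Monic e M → M ∣ₚ natₚ (suc c) *ₚ Q → M ∣ₚ Q
∣ₚ-cancel-nat {e} {M} {Q} c mM (dividesₚ G hG) =
  dividesₚ H (≈-trans hQ (≈-trans (+-cong (≈-refl {H *ₚ M}) (mk≈ R-zero)) (+ₚ-identityʳ (H *ₚ M))))
  where
  div : Σ Poly λ r → (Q ≈ divMonic Q M *ₚ M +ₚ r) × DegBelow e r
  div = divMonic-correct Q M mM
  H : Poly
  H = divMonic Q M
  R : Poly
  R = proj₁ div
  hQ : Q ≈ H *ₚ M +ₚ R
  hQ = proj₁ (proj₂ div)
  c' : Poly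
  c' = natₚ (suc c)
  coeff-cR : ∀ i → coeff (c' *ₚ R) i ≡ + suc c *ℤ coeff R i
  coeff-cR i = trans (sym (at (scale≈const* (+ suc c) R) i)) (coeff-scale (+ suc c) R i)
  -- (G - c·H)·M ≈ c·R has degree < e, so G - c·H vanishes and hence so does c·R.
  cR≈ : (G -ₚ c' *ₚ H) *ₚ M ≈ c' *ₚ R
  cR≈ = ≈-trans (expand-difference c' G H M) (≈-trans (+-cong (≈-sym hG) ≈-refl)
          (≈-trans (+-cong (*-congʳ c' hQ) ≈-refl) (cancel-quotient c' H M R)))
  small : DegBelow e (c' *ₚ R)
  small i le = trans (coeff-cR i) (trans (cong (+ suc c *ℤ_) (proj₂ (proj₂ div) i le)) (ℤP.*-zeroʳ (+ suc c)))
  R-zero : IsZero R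
  R-zero i = positive-cancel c (trans (sym (coeff-cR i)) (trans (sym (at cR≈ i))
                  (IsZero-*ˡ (G -ₚ c' *ₚ H) M (monic-cancel-zero (G -ₚ c' *ₚ H) mM (DegBelow-≈ (≈-sym cR≈) small)) i)))

MonicSome : Poly → Set
MonicSome p = Σ ℕ λ e → Monic e p

zero-or-top : ∀ P → IsZero P ⊎ Σ ℕ λ k → DegBelow (suc k) P × coeff P k ≢ 0ℤ
zero-or-top [] = inj₁ (λ _ → refl)
zero-or-top (a ∷ P) with zero-or-top P
... | inj₂ (k , s , nz) = inj₂ (suc k , (λ { zero () ; (suc i) (s≤s le) → s i le }) , nz)
... | inj₁ z with a ℤ.≟ 0ℤ
...   | yes a0 = inj₁ (λ { zero → a0 ; (suc i) → z i })
...   | no  an = inj₂ (0 , (λ { zero () ; (suc i) _ → z i }) , an)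

monic-quotient : ∀ P {E F} → MonicSome E → MonicSome F → P *ₚ E ≈ F → MonicSome P
monic-quotient P {E} {F} (eE , monicOf sE cE) (eF , monicOf sF cF) h with zero-or-top P
... | inj₁ z = ⊥-elim (1≢0 (trans (sym cF) (trans (sym (at h eF)) (IsZero-*ˡ P E z eF))))
... | inj₂ (k , sP , nz) = k , monicOf sP (trans (sym topP) (trans topPE top-F))
  where
  top : DegBelow (suc (k + eE)) (P *ₚ E) × coeff (P *ₚ E) (k + eE) ≡ coeff P k *ℤ coeff E eE
  top = *-top k eE P E sP sE
  topP : coeff (P *ₚ E) (k + eE) ≡ coeff P k
  topP = trans (proj₂ top) (trans (cong (coeff P k *ℤ_) cE) (ℤP.*-identityʳ _))
  topPE : coeff (P *ₚ E) (k + eE) ≡ coeff F (k + eE)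
  topPE = at h (k + eE)
  -- comparing degrees: k + eE = eF, since both top coefficients are nonzero
  top-F : coeff F (k + eE) ≡ 1ℤ
  top-F with ℕP.<-cmp (k + eE) eF
  ... | tri< lt _ _ = ⊥-elim (1≢0 (trans (sym cF) (trans (sym (at h eF)) (proj₁ top eF lt))))
  ... | tri≈ _ eq _ = trans (cong (coeff F) eq) cF
  ... | tri> _ _ gt = ⊥-elim (nz (trans (sym topP) (trans topPE (sF (k + eE) gt))))

Xpow-+ : ∀ a b → Xpow (a + b) ≈ Xpow a *ₚ Xpow b
Xpow-+ zero    b = ≈-sym (*-identityˡ (Xpow b))
Xpow-+ (suc a) b = ≈-trans (shift-cong (Xpow-+ a b)) (≈-sym (shift-*ˡ (Xpow a) (Xpow b)))

Xpow-1 : ℕ → Poly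
Xpow-1 a = Xpow a -ₚ 𝟙

Xpow-1-monic : ∀ n → Monic (suc n) (Xpow-1 (suc n))
Xpow-1-monic n = monicOf deg top
  where
  deg : DegBelow (suc (suc n)) (Xpow-1 (suc n))
  deg (suc i) (s≤s le) = trans (coeff-- (Xpow (suc n)) 𝟙 (suc i)) (cong (_-ℤ 0ℤ) (bounded (Xpow-monic n) i le))
  top : coeff (Xpow-1 (suc n)) (suc n) ≡ 1ℤ
  top = trans (coeff-- (Xpow (suc n)) 𝟙 (suc n)) (cong (_-ℤ 0ℤ) (leading (Xpow-monic n)))

geom : ℕ → ℕ → Poly
geom g zero    = []
geom g (suc m) = 𝟙 +ₚ Xpow g *ₚ geom g m

geom-sum : ∀ g m → Xpow-1 g *ₚ geom g m ≈ Xpow-1 (m * g)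
geom-sum g zero    = ≈-trans (*-zeroʳ (Xpow-1 g)) (≈-sym (+ₚ-inverseʳ 𝟙))
geom-sum g (suc m) = ≈-trans (step (Xpow g) (Xpow (m * g)) (geom g m) (geom-sum g m))
                             (+-cong (≈-sym (Xpow-+ g (m * g))) ≈-refl)
  where
  step : ∀ A B p → (A +ₚ negₚ 𝟙) *ₚ p ≈ B +ₚ negₚ 𝟙 →
         (A +ₚ negₚ 𝟙) *ₚ (𝟙 +ₚ A *ₚ p) ≈ A *ₚ B +ₚ negₚ 𝟙
  step A B p e = ≈-trans (expand A p) (≈-trans (+-cong ≈-refl (*-congʳ A e)) (collect A B))
    where
    expand : ∀ A p → (A +ₚ negₚ 𝟙) *ₚ (𝟙 +ₚ A *ₚ p) ≈ (A +ₚ negₚ 𝟙) +ₚ A *ₚ ((A +ₚ negₚ 𝟙) *ₚ p)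
    expand A p = solve (A ∷ p ∷ []) Poly-ring
    collect : ∀ A B → (A +ₚ negₚ 𝟙) +ₚ A *ₚ (B +ₚ negₚ 𝟙) ≈ A *ₚ B +ₚ negₚ 𝟙
    collect A B = solve (A ∷ B ∷ []) Poly-ring

Xpow≡1 : ∀ g → Xpow g ≡[ Xpow-1 g ] 𝟙
Xpow≡1 g = congruent (∣ₚ-refl (Xpow-1 g))

-- Modulo q^g - 1 we have q^g ≡ 1, hence geom g m ≡ m.
geom-≡-nat : ∀ g m → geom g m ≡[ Xpow-1 g ] natₚ m
geom-≡-nat g zero    = ≈⇒≡ (≈-sym const-0)
geom-≡-nat g (suc m) = ≡-trans (≡-+ (≡-refl {x = 𝟙}) (≡-* (Xpow≡1 g) (geom-≡-nat g m)))
                               (≈⇒≡ (+-cong (≈-refl {𝟙}) (*-identityˡ (natₚ m))))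

Xpow-1-∣ : ∀ {d n} → d ∣ n → Xpow-1 d ∣ₚ Xpow-1 n
Xpow-1-∣ {d} (divides m refl) = dividesₚ (geom d m) (≈-trans (≈-sym (geom-sum d m)) (*-comm (Xpow-1 d) (geom d m)))

-- Ideals (A, B) generated by two polynomials.  Since q^a - 1 and q^b - 1 in an ideal put
-- q^(a-b) - 1 there, Euclid's algorithm on exponents reaches q^g - 1 for a common divisor g.

InIdeal : Poly → Poly → Poly → Set
InIdeal A B x = Σ Poly λ u → Σ Poly λ v → x ≈ u *ₚ A +ₚ v *ₚ B

InIdeal-resp : ∀ {A B x y} → x ≈ y → InIdeal A B x → InIdeal A B y
InIdeal-resp e (u , v , h) = u , v , ≈-trans (≈-sym e) h

InIdeal-respʳ : ∀ {A B B' x} → B ≈ B' → InIdeal A B x → InIdeal A B' x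
InIdeal-respʳ e (u , v , h) = u , v , ≈-trans h (+-cong ≈-refl (*-congʳ v e))

InIdeal-+ : ∀ {A B x y} → InIdeal A B x → InIdeal A B y → InIdeal A B (x +ₚ y)
InIdeal-+ {A} {B} (u , v , h) (u' , v' , h') = u +ₚ u' , v +ₚ v' , ≈-trans (+-cong h h') (lemma u v u' v' A B)
  where
  lemma : ∀ u v u' v' A B → (u *ₚ A +ₚ v *ₚ B) +ₚ (u' *ₚ A +ₚ v' *ₚ B) ≈ (u +ₚ u') *ₚ A +ₚ (v +ₚ v') *ₚ B
  lemma u v u' v' A B = solve (u ∷ v ∷ u' ∷ v' ∷ A ∷ B ∷ []) Poly-ring

InIdeal-* : ∀ {A B x} c → InIdeal A B x → InIdeal A B (c *ₚ x)
InIdeal-* {A} {B} c (u , v , h) = c *ₚ u , c *ₚ v , ≈-trans (*-congʳ c h) (lemma c u v A B)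
  where
  lemma : ∀ c u v A B → c *ₚ (u *ₚ A +ₚ v *ₚ B) ≈ (c *ₚ u) *ₚ A +ₚ (c *ₚ v) *ₚ B
  lemma c u v A B = solve (c ∷ u ∷ v ∷ A ∷ B ∷ []) Poly-ring

InIdeal-neg : ∀ {A B x} → InIdeal A B x → InIdeal A B (negₚ x)
InIdeal-neg {x = x} i = InIdeal-resp (lemma x) (InIdeal-* (negₚ 𝟙) i)
  where
  lemma : ∀ x → negₚ 𝟙 *ₚ x ≈ negₚ x
  lemma x = solve (x ∷ []) Poly-ring

InIdeal-left : ∀ {A B x} → A ∣ₚ x → InIdeal A B x
InIdeal-left {A} (dividesₚ H h) = H , [] , ≈-trans h (≈-sym (+ₚ-identityʳ (H *ₚ A)))

InIdeal-right : ∀ {A B x} → B ∣ₚ x → InIdeal A B x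
InIdeal-right (dividesₚ H h) = [] , H , h

InIdeal-*-right : ∀ {A B D x y} → InIdeal A B x → InIdeal A D y → InIdeal A (B *ₚ D) (x *ₚ y)
InIdeal-*-right {A} {B} {D} {x} {y} (u , v , h) (u' , v' , h') =
  u *ₚ (u' *ₚ A +ₚ v' *ₚ D) +ₚ v *ₚ (B *ₚ u') , v *ₚ v' ,
  ≈-trans (*-congˡ y h) (≈-trans (*-congʳ (u *ₚ A +ₚ v *ₚ B) h') (lemma u v A B u' v' D))
  where
  lemma : ∀ u v A B u' v' D → (u *ₚ A +ₚ v *ₚ B) *ₚ (u' *ₚ A +ₚ v' *ₚ D) ≈
          (u *ₚ (u' *ₚ A +ₚ v' *ₚ D) +ₚ v *ₚ (B *ₚ u')) *ₚ A +ₚ (v *ₚ v') *ₚ (B *ₚ D)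
  lemma u v A B u' v' D = solve (u ∷ v ∷ A ∷ B ∷ u' ∷ v' ∷ D ∷ []) Poly-ring

-- One subtraction step of Euclid: q^a - 1 = (q^(a+b) - 1) - q^a (q^b - 1).
euclid-step : ∀ {A B} a b → InIdeal A B (Xpow-1 (a + b)) → InIdeal A B (Xpow-1 b) → InIdeal A B (Xpow-1 a)
euclid-step {A} {B} a b i₁ i₂ = InIdeal-resp (identity (Xpow a) (Xpow b) (Xpow (a + b)) (Xpow-+ a b))
  (InIdeal-+ i₁ (InIdeal-neg (InIdeal-* (Xpow a) i₂)))
  where
  identity : ∀ P Q R → R ≈ P *ₚ Q → (R +ₚ negₚ 𝟙) +ₚ negₚ (P *ₚ (Q +ₚ negₚ 𝟙)) ≈ P +ₚ negₚ 𝟙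
  identity P Q R e = ≈-trans (+-cong (+-cong e ≈-refl) ≈-refl) (lemma P Q)
    where
    lemma : ∀ P Q → (P *ₚ Q +ₚ negₚ 𝟙) +ₚ negₚ (P *ₚ (Q +ₚ negₚ 𝟙)) ≈ P +ₚ negₚ 𝟙
    lemma P Q = solve (P ∷ Q ∷ []) Poly-ring

record CommonExponent (A B : Poly) (a b : ℕ) : Set where
  constructor common
  field
    g      : ℕ
    g∣a    : g ∣ a
    g∣b    : g ∣ b
    inIdeal : InIdeal A B (Xpow-1 g)

euclid : ∀ {A B} f a b → a + b < f → InIdeal A B (Xpow-1 a) → InIdeal A B (Xpow-1 b) → CommonExponent A B a b
euclid (suc f) a       zero    _  ia ib = common a ∣-refl (a ∣0) ia
euclid (suc f) zero    (suc b) _  ia ib = common (suc b) (suc b ∣0) ∣-refl ib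
euclid {A} {B} (suc f) (suc a) (suc b) lt ia ib with ℕP.≤-total (suc b) (suc a)
... | inj₁ b≤a = smaller (euclid f (suc a ∸ suc b) (suc b) fuel (euclid-step _ _ ia′ ib) ib)
  where
  e : suc a ∸ suc b + suc b ≡ suc a
  e = ℕP.m∸n+n≡m b≤a
  ia′ : InIdeal A B (Xpow-1 (suc a ∸ suc b + suc b))
  ia′ = subst (λ z → InIdeal A B (Xpow-1 z)) (sym e) ia
  fuel : suc a ∸ suc b + suc b < f
  fuel = subst (_< f) (sym e) (ℕP.<-≤-trans (ℕP.m<m+n (suc a) (s≤s z≤n)) (ℕP.≤-pred lt))
  smaller : CommonExponent A B (suc a ∸ suc b) (suc b) → CommonExponent A B (suc a) (suc b)
  smaller (common g g₁ g₂ i) = common g (∣m∸n∣n⇒∣m g b≤a g₁ g₂) g₂ i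
... | inj₂ a≤b = smaller (euclid f (suc a) (suc b ∸ suc a) fuel ia (euclid-step _ _ ib′ ia))
  where
  e : suc b ∸ suc a + suc a ≡ suc b
  e = ℕP.m∸n+n≡m a≤b
  ib′ : InIdeal A B (Xpow-1 (suc b ∸ suc a + suc a))
  ib′ = subst (λ z → InIdeal A B (Xpow-1 z)) (sym e) ib
  fuel : suc a + (suc b ∸ suc a) < f
  fuel = subst (_< f) (trans (sym e) (ℕP.+-comm _ (suc a))) (ℕP.<-≤-trans (ℕP.m<n+m (suc b) (s≤s z≤n)) (ℕP.≤-pred lt))
  smaller : CommonExponent A B (suc a) (suc b ∸ suc a) → CommonExponent A B (suc a) (suc b)
  smaller (common g g₁ g₂ i) = common g g₁ (∣m∸n∣n⇒∣m g a≤b g₂ g₁) i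

qint-+ : ∀ a b → qint (a + b) ≈ qint a +ₚ Xpow a *ₚ qint b
qint-+ zero    b = ≈-sym (*-identityˡ (qint b))
qint-+ (suc a) b = ≈-trans (∷-cong (sym (ℤP.+-identityʳ 1ℤ)) (qint-+ a b))
                           (+-cong (≈-refl {1ℤ ∷ qint a}) (≈-sym (shift-*ˡ (Xpow a) (qint b))))

qint-Xpow-1 : ∀ m → Xpow-1 1 *ₚ qint m ≈ Xpow-1 m
qint-Xpow-1 m = ≈-trans (*-congʳ (Xpow-1 1) (qint≈geom m))
                        (≈-trans (geom-sum 1 m) (≡⇒≈ (cong Xpow-1 (ℕP.*-identityʳ m))))
  where
  qint≈geom : ∀ m → qint m ≈ geom 1 m
  qint≈geom zero    = ≈-refl
  qint≈geom (suc m) = ≈-sym (≈-trans (+-cong (≈-refl {𝟙}) (≈-trans (shift-*ˡ 𝟙 (geom 1 m)) (shift-cong (*-identityˡ (geom 1 m)))))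
                                     (∷-cong (ℤP.+-identityʳ 1ℤ) (≈-sym (qint≈geom m))))

qint-monic : ∀ m → Monic m (qint (suc m))
qint-monic m = monicOf (subst (λ z → DegBelow z (qint (suc m))) (LP.length-replicate (suc m)) (DegBelow-length (qint (suc m))))
                      (top m)
  where
  top : ∀ m → coeff (qint (suc m)) m ≡ 1ℤ
  top zero    = refl
  top (suc m) = top m

qfact-monic : ∀ m → MonicSome (qfact m)
qfact-monic zero    = 0 , 𝟙-monic
qfact-monic (suc m) = let (e , me) = qfact-monic m in e + m , Monic-* (qfact m) (qint (suc m)) me (qint-monic m)

qfact²-monic : ∀ k j → MonicSome (qfact k *ₚ qfact j)
qfact²-monic k j = let (e₁ , m₁) = qfact-monic k ; (e₂ , m₂) = qfact-monic j in e₁ + e₂ , Monic-* (qfact k) (qfact j) m₁ m₂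

qbin : ℕ → ℕ → Poly
qbin m       zero    = 𝟙
qbin zero    (suc k) = []
qbin (suc m) (suc k) = qbin m k +ₚ Xpow (suc k) *ₚ qbin m (suc k)

qbin-vanish : ∀ m k → m < k → qbin m k ≈ []
qbin-vanish zero    (suc k) _        = ≈-refl
qbin-vanish (suc m) (suc k) (s≤s lt) = +-cong (qbin-vanish m k lt)
  (≈-trans (*-congʳ (Xpow (suc k)) (qbin-vanish m (suc k) (ℕP.m<n⇒m<1+n lt))) (*-zeroʳ (Xpow (suc k))))

qbin-diag : ∀ m → qbin m m ≈ 𝟙
qbin-diag zero    = ≈-refl
qbin-diag (suc m) = ≈-trans (+-cong (qbin-diag m)
  (≈-trans (*-congʳ (Xpow (suc m)) (qbin-vanish m (suc m) (ℕP.n<1+n m))) (*-zeroʳ (Xpow (suc m))))) (+ₚ-identityʳ 𝟙)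

m∸k≡suc : ∀ m k → k < m → m ∸ k ≡ suc (m ∸ suc k)
m∸k≡suc (suc m) zero    _        = refl
m∸k≡suc (suc m) (suc k) (s≤s lt) = m∸k≡suc m k lt

private
  pascal-top : ∀ A B Xk Fk Q Fr → (A +ₚ Xk *ₚ B) *ₚ ((Fk *ₚ Q) *ₚ Fr) ≈
                                  (A *ₚ (Fk *ₚ Fr)) *ₚ Q +ₚ (Xk *ₚ B) *ₚ ((Fk *ₚ Q) *ₚ Fr)
  pascal-top A B Xk Fk Q Fr = solve (A ∷ B ∷ Xk ∷ Fk ∷ Q ∷ Fr ∷ []) Poly-ring

  pascal-mid : ∀ A B Xk Fk Qk Fj Qj → (A +ₚ Xk *ₚ B) *ₚ ((Fk *ₚ Qk) *ₚ (Fj *ₚ Qj)) ≈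
               (A *ₚ (Fk *ₚ (Fj *ₚ Qj))) *ₚ Qk +ₚ Xk *ₚ ((B *ₚ ((Fk *ₚ Qk) *ₚ Fj)) *ₚ Qj)
  pascal-mid A B Xk Fk Qk Fj Qj = solve (A ∷ B ∷ Xk ∷ Fk ∷ Qk ∷ Fj ∷ Qj ∷ []) Poly-ring

  factor-left : ∀ F Q X Q' → F *ₚ Q +ₚ X *ₚ (F *ₚ Q') ≈ F *ₚ (Q +ₚ X *ₚ Q')
  factor-left F Q X Q' = solve (F ∷ Q ∷ X ∷ Q' ∷ []) Poly-ring

qbin-factorial : ∀ m k → k ≤ m → qbin m k *ₚ (qfact k *ₚ qfact (m ∸ k)) ≈ qfact m
qbin-factorial m       zero    _ = ≈-trans (*-identityˡ _) (*-identityˡ (qfact m))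
qbin-factorial (suc m) (suc k) (s≤s k≤m) with ℕP.m≤n⇒m<n∨m≡n k≤m
... | inj₂ refl = begin
  (qbin k k +ₚ Xpow (suc k) *ₚ qbin k (suc k)) *ₚ ((qfact k *ₚ qint (suc k)) *ₚ qfact (k ∸ k))
    ≈⟨ pascal-top (qbin k k) _ (Xpow (suc k)) (qfact k) (qint (suc k)) (qfact (k ∸ k)) ⟩
  (qbin k k *ₚ (qfact k *ₚ qfact (k ∸ k))) *ₚ qint (suc k) +ₚ (Xpow (suc k) *ₚ qbin k (suc k)) *ₚ F
    ≈⟨ +-cong (*-congˡ (qint (suc k)) (qbin-factorial k k ℕP.≤-refl))
              (*-congˡ F (≈-trans (*-congʳ (Xpow (suc k)) (qbin-vanish k (suc k) (ℕP.n<1+n k))) (*-zeroʳ (Xpow (suc k))))) ⟩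
  qfact k *ₚ qint (suc k) +ₚ []
    ≈⟨ +ₚ-identityʳ _ ⟩
  qfact (suc k) ∎
  where
  open ≈-Reasoning
  F : Poly
  F = (qfact k *ₚ qint (suc k)) *ₚ qfact (k ∸ k)
... | inj₁ k<m rewrite m∸k≡suc m k k<m = begin
  (qbin m k +ₚ Xk *ₚ qbin m (suc k)) *ₚ ((qfact k *ₚ qint (suc k)) *ₚ (qfact j *ₚ qint (suc j)))
    ≈⟨ pascal-mid (qbin m k) (qbin m (suc k)) Xk (qfact k) (qint (suc k)) (qfact j) (qint (suc j)) ⟩
  (qbin m k *ₚ (qfact k *ₚ qfact (suc j))) *ₚ qint (suc k) +ₚ Xk *ₚ ((qbin m (suc k) *ₚ (qfact (suc k) *ₚ qfact j)) *ₚ qint (suc j))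
    ≈⟨ +-cong (*-congˡ (qint (suc k)) (subst (λ z → qbin m k *ₚ (qfact k *ₚ qfact z) ≈ qfact m) (m∸k≡suc m k k<m)
                                              (qbin-factorial m k k≤m)))
              (*-congʳ Xk (*-congˡ (qint (suc j)) (qbin-factorial m (suc k) k<m))) ⟩
  qfact m *ₚ qint (suc k) +ₚ Xk *ₚ (qfact m *ₚ qint (suc j))
    ≈⟨ factor-left (qfact m) (qint (suc k)) Xk (qint (suc j)) ⟩
  qfact m *ₚ (qint (suc k) +ₚ Xk *ₚ qint (suc j))
    ≈⟨ *-congʳ (qfact m) (≈-trans (≈-sym (qint-+ (suc k) (suc j))) (≡⇒≈ (cong qint (sum-exponents)))) ⟩
  qfact (suc m) ∎
  where
  open ≈-Reasoning
  j : ℕ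
  j = m ∸ suc k
  Xk : Poly
  Xk = Xpow (suc k)
  sum-exponents : suc k + suc j ≡ suc m
  sum-exponents = trans (ℕP.+-suc (suc k) j) (cong suc (ℕP.m+[n∸m]≡n k<m))

qbinom≈qbin : ∀ m k → k ≤ m → qbinom m k ≈ qbin m k
qbinom≈qbin m k le = divMonic-exact (qfact m) (qfact k *ₚ qfact (m ∸ k)) (qbin m k)
  (proj₂ (qfact²-monic k (m ∸ k))) (≈-sym (qbin-factorial m k le))

-- The mirrored Pascal rule  qbin (m+1) (k+1) = qbin m (k+1) + q^(m-k) qbin m k,  obtained by
-- comparing both sides after multiplication with the monic [k+1]! [m-k]!.
qbin-pascal′ : ∀ m k → k ≤ m → qbin (suc m) (suc k) ≈ qbin m (suc k) +ₚ Xpow (m ∸ k) *ₚ qbin m k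
qbin-pascal′ m k le = monic-cancel _ _ (proj₂ (qfact²-monic (suc k) (m ∸ k)))
  (≈-trans (qbin-factorial (suc m) (suc k) (s≤s le)) (≈-sym rhs))
  where
  M : Poly
  M = qfact (suc k) *ₚ qfact (m ∸ k)
  first : qbin m (suc k) *ₚ M ≈ qfact m *ₚ qint (m ∸ k)
  first with ℕP.m≤n⇒m<n∨m≡n le
  ... | inj₂ refl = ≈-trans (*-congˡ M (qbin-vanish k (suc k) (ℕP.n<1+n k)))
                            (≈-sym (≈-trans (*-congʳ (qfact k) (≡⇒≈ (cong qint (ℕP.n∸n≡0 k)))) (*-zeroʳ (qfact k))))
  ... | inj₁ k<m rewrite m∸k≡suc m k k<m =
    ≈-trans (reassoc (qbin m (suc k)) (qfact (suc k)) (qfact (m ∸ suc k)) (qint (suc (m ∸ suc k))))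
            (*-congˡ (qint (suc (m ∸ suc k))) (qbin-factorial m (suc k) k<m))
    where
    reassoc : ∀ A F F' Q → A *ₚ (F *ₚ (F' *ₚ Q)) ≈ (A *ₚ (F *ₚ F')) *ₚ Q
    reassoc A F F' Q = solve (A ∷ F ∷ F' ∷ Q ∷ []) Poly-ring
  second : (Xpow (m ∸ k) *ₚ qbin m k) *ₚ M ≈ Xpow (m ∸ k) *ₚ (qfact m *ₚ qint (suc k))
  second = ≈-trans (reassoc (Xpow (m ∸ k)) (qbin m k) (qfact k) (qint (suc k)) (qfact (m ∸ k)))
                   (*-congʳ (Xpow (m ∸ k)) (*-congˡ (qint (suc k)) (qbin-factorial m k le)))
    where
    reassoc : ∀ Y A F Q F' → (Y *ₚ A) *ₚ ((F *ₚ Q) *ₚ F') ≈ Y *ₚ ((A *ₚ (F *ₚ F')) *ₚ Q)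
    reassoc Y A F Q F' = solve (Y ∷ A ∷ F ∷ Q ∷ F' ∷ []) Poly-ring
  rhs : (qbin m (suc k) +ₚ Xpow (m ∸ k) *ₚ qbin m k) *ₚ M ≈ qfact (suc m)
  rhs = begin
    (qbin m (suc k) +ₚ Xpow (m ∸ k) *ₚ qbin m k) *ₚ M
      ≈⟨ *-distribʳ (qbin m (suc k)) _ M ⟩
    qbin m (suc k) *ₚ M +ₚ (Xpow (m ∸ k) *ₚ qbin m k) *ₚ M
      ≈⟨ +-cong first second ⟩
    qfact m *ₚ qint (m ∸ k) +ₚ Xpow (m ∸ k) *ₚ (qfact m *ₚ qint (suc k))
      ≈⟨ factor-left (qfact m) (qint (m ∸ k)) (Xpow (m ∸ k)) (qint (suc k)) ⟩
    qfact m *ₚ (qint (m ∸ k) +ₚ Xpow (m ∸ k) *ₚ qint (suc k))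
      ≈⟨ *-congʳ (qfact m) (≈-trans (≈-sym (qint-+ (m ∸ k) (suc k)))
           (≡⇒≈ (cong qint (trans (ℕP.+-suc (m ∸ k) k) (cong suc (ℕP.m∸n+n≡m le)))))) ⟩
    qfact (suc m) ∎
    where open ≈-Reasoning

qbin-absorb : ∀ n i → i ≤ n → Xpow-1 (suc i) *ₚ qbin (suc n) (suc i) ≈ Xpow-1 (suc n) *ₚ qbin n i
qbin-absorb n i le = begin
  Xpow-1 (suc i) *ₚ qbin (suc n) (suc i)            ≈⟨ *-congˡ _ (≈-sym (qint-Xpow-1 (suc i))) ⟩
  (Xpow-1 1 *ₚ qint (suc i)) *ₚ qbin (suc n) (suc i) ≈⟨ swap (Xpow-1 1) (qint (suc i)) _ ⟩
  Xpow-1 1 *ₚ (qbin (suc n) (suc i) *ₚ qint (suc i)) ≈⟨ *-congʳ (Xpow-1 1) qint-absorb ⟩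
  Xpow-1 1 *ₚ (qbin n i *ₚ qint (suc n))             ≈⟨ ≈-sym (swap (Xpow-1 1) (qint (suc n)) _) ⟩
  (Xpow-1 1 *ₚ qint (suc n)) *ₚ qbin n i             ≈⟨ *-congˡ _ (qint-Xpow-1 (suc n)) ⟩
  Xpow-1 (suc n) *ₚ qbin n i                         ∎
  where
  open ≈-Reasoning
  swap : ∀ D Q A → (D *ₚ Q) *ₚ A ≈ D *ₚ (A *ₚ Q)
  swap D Q A = solve (D ∷ Q ∷ A ∷ []) Poly-ring
  -- qbin (n+1) (i+1) [i+1] = qbin n i [n+1], comparing after multiplication by [i]! [n-i]!
  qint-absorb : qbin (suc n) (suc i) *ₚ qint (suc i) ≈ qbin n i *ₚ qint (suc n)
  qint-absorb = monic-cancel _ _ (proj₂ (qfact²-monic i (n ∸ i)))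
    (≈-trans (reassoc (qbin (suc n) (suc i)) (qfact i) (qint (suc i)) (qfact (n ∸ i)))
    (≈-trans (qbin-factorial (suc n) (suc i) (s≤s le))
    (≈-trans (*-congˡ (qint (suc n)) (≈-sym (qbin-factorial n i le)))
             (swap′ (qbin n i) (qfact i *ₚ qfact (n ∸ i)) (qint (suc n))))))
    where
    reassoc : ∀ A F Q F' → (A *ₚ Q) *ₚ (F *ₚ F') ≈ A *ₚ ((F *ₚ Q) *ₚ F')
    reassoc A F Q F' = solve (A ∷ F ∷ Q ∷ F' ∷ []) Poly-ring
    swap′ : ∀ B K Q → (B *ₚ K) *ₚ Q ≈ (B *ₚ Q) *ₚ K
    swap′ B K Q = solve (B ∷ K ∷ Q ∷ []) Poly-ring

choose2 : ℕ → ℕ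
choose2 zero    = 0
choose2 (suc k) = choose2 k + k

twisted : ℕ → ℕ → Poly
twisted m k = Xpow (choose2 k) *ₚ qbin m k

twisted-vanish : ∀ m k → m < k → twisted m k ≈ []
twisted-vanish m k lt = ≈-trans (*-congʳ (Xpow (choose2 k)) (qbin-vanish m k lt)) (*-zeroʳ (Xpow (choose2 k)))

twisted-0 : ∀ m → twisted m 0 ≈ 𝟙
twisted-0 m = *-identityˡ 𝟙

twisted-diag : ∀ m → twisted m m ≈ Xpow (choose2 m)
twisted-diag m = ≈-trans (*-congʳ (Xpow (choose2 m)) (qbin-diag m)) (*-identityʳ (Xpow (choose2 m)))

-- Pascal's rule for the twisted binomial: the mirrored rule, using
-- q^(choose2 (k+1) + (m-k)) = q^(m + choose2 k).
twisted-pascal : ∀ m k → twisted (suc m) (suc k) ≈ twisted m (suc k) +ₚ Xpow m *ₚ twisted m k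
twisted-pascal m k with ℕP.≤-<-connex k m
... | inj₂ m<k = ≈-trans (twisted-vanish (suc m) (suc k) (s≤s m<k)) (≈-sym (+-cong
      (twisted-vanish m (suc k) (ℕP.m<n⇒m<1+n m<k))
      (≈-trans (*-congʳ (Xpow m) (twisted-vanish m k m<k)) (*-zeroʳ (Xpow m)))))
... | inj₁ k≤m = begin
  Xpow (choose2 k + k) *ₚ qbin (suc m) (suc k)
    ≈⟨ *-congʳ (Xpow (choose2 k + k)) (qbin-pascal′ m k k≤m) ⟩
  Xpow (choose2 k + k) *ₚ (qbin m (suc k) +ₚ Xpow (m ∸ k) *ₚ qbin m k)
    ≈⟨ distribute (Xpow (choose2 k + k)) (qbin m (suc k)) (Xpow (m ∸ k)) (qbin m k) ⟩
  twisted m (suc k) +ₚ (Xpow (choose2 k + k) *ₚ Xpow (m ∸ k)) *ₚ qbin m k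
    ≈⟨ +-cong ≈-refl (*-congˡ (qbin m k) exponents) ⟩
  twisted m (suc k) +ₚ (Xpow m *ₚ Xpow (choose2 k)) *ₚ qbin m k
    ≈⟨ +-cong ≈-refl (*-assoc (Xpow m) (Xpow (choose2 k)) (qbin m k)) ⟩
  twisted m (suc k) +ₚ Xpow m *ₚ twisted m k ∎
  where
  open ≈-Reasoning
  distribute : ∀ P B Q C → P *ₚ (B +ₚ Q *ₚ C) ≈ P *ₚ B +ₚ (P *ₚ Q) *ₚ C
  distribute P B Q C = solve (P ∷ B ∷ Q ∷ C ∷ []) Poly-ring
  exponents : Xpow (choose2 k + k) *ₚ Xpow (m ∸ k) ≈ Xpow m *ₚ Xpow (choose2 k)
  exponents = ≈-trans (≈-sym (Xpow-+ (choose2 k + k) (m ∸ k))) (≈-trans (≡⇒≈ (cong Xpow e)) (Xpow-+ m (choose2 k)))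
    where
    e : choose2 k + k + (m ∸ k) ≡ m + choose2 k
    e = trans (ℕP.+-assoc (choose2 k) k (m ∸ k)) (trans (cong (λ z → choose2 k + z) (ℕP.m+[n∸m]≡n k≤m)) (ℕP.+-comm (choose2 k) m))

sumUpTo : (ℕ → Poly) → ℕ → Poly
sumUpTo f zero    = f zero
sumUpTo f (suc k) = sumUpTo f k +ₚ f (suc k)

sum-cong : ∀ f g k → (∀ i → i ≤ k → f i ≈ g i) → sumUpTo f k ≈ sumUpTo g k
sum-cong f g zero    h = h 0 z≤n
sum-cong f g (suc k) h = +-cong (sum-cong f g k (λ i le → h i (ℕP.m≤n⇒m≤1+n le))) (h (suc k) ℕP.≤-refl)

sum-first : ∀ f k → sumUpTo f (suc k) ≈ f 0 +ₚ sumUpTo (λ i → f (suc i)) k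
sum-first f zero    = ≈-refl
sum-first f (suc k) = ≈-trans (+-cong (sum-first f k) ≈-refl) (+ₚ-assoc (f 0) _ (f (suc (suc k))))

sum-+ : ∀ f g k → sumUpTo (λ i → f i +ₚ g i) k ≈ sumUpTo f k +ₚ sumUpTo g k
sum-+ f g zero    = ≈-refl
sum-+ f g (suc k) = ≈-trans (+-cong (sum-+ f g k) ≈-refl) (+ₚ-interchange (sumUpTo f k) (sumUpTo g k) (f (suc k)) (g (suc k)))

sum-*ˡ : ∀ A f k → sumUpTo (λ i → A *ₚ f i) k ≈ A *ₚ sumUpTo f k
sum-*ˡ A f zero    = ≈-refl
sum-*ˡ A f (suc k) = ≈-trans (+-cong (sum-*ˡ A f k) ≈-refl) (≈-sym (*-distribˡ A (sumUpTo f k) (f (suc k))))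

sum-neg : ∀ f k → sumUpTo (λ i → negₚ (f i)) k ≈ negₚ (sumUpTo f k)
sum-neg f zero    = ≈-refl
sum-neg f (suc k) = ≈-trans (+-cong (sum-neg f k) ≈-refl) (lemma (sumUpTo f k) (f (suc k)))
  where
  lemma : ∀ a b → negₚ a +ₚ negₚ b ≈ negₚ (a +ₚ b)
  lemma a b = solve (a ∷ b ∷ []) Poly-ring

sum-only-first : ∀ f k → (∀ i → 1 ≤ i → i ≤ k → f i ≈ []) → sumUpTo f k ≈ f 0
sum-only-first f zero    h = ≈-refl
sum-only-first f (suc k) h = ≈-trans (+-cong (sum-only-first f k (λ i a b → h i a (ℕP.m≤n⇒m≤1+n b)))
                                             (h (suc k) (s≤s z≤n) ℕP.≤-refl)) (+ₚ-identityʳ (f 0))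

sum-∣ : ∀ M f k → (∀ i → i ≤ k → M ∣ₚ f i) → M ∣ₚ sumUpTo f k
sum-∣ M f zero    h = h 0 z≤n
sum-∣ M f (suc k) h = ∣ₚ-+ (sum-∣ M f k (λ i le → h i (ℕP.m≤n⇒m≤1+n le))) (h (suc k) ℕP.≤-refl)

sum-≡-first : ∀ M f k → (∀ i → 1 ≤ i → i ≤ k → M ∣ₚ f i) → sumUpTo f k ≡[ M ] f 0
sum-≡-first M f zero    h = ≡-refl
sum-≡-first M f (suc k) h = ≡-trans (≡-+ (sum-≡-first M f k (λ i a b → h i a (ℕP.m≤n⇒m≤1+n b)))
                                         (∣ₚ⇒≡0 (h (suc k) (s≤s z≤n) ℕP.≤-refl)))
                                    (≈⇒≡ (+ₚ-identityʳ (f 0)))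

sum-≡-two : ∀ M f k j → 1 ≤ j → j ≤ k → (∀ i → 1 ≤ i → i ≤ k → i ≢ j → M ∣ₚ f i) →
            sumUpTo f k ≡[ M ] f 0 +ₚ f j
sum-≡-two M f zero    (suc j) _ () h
sum-≡-two M f (suc k) j j≥1 j≤k h with ℕP.m≤n⇒m<n∨m≡n j≤k
... | inj₂ refl = ≡-+ (sum-≡-first M f k (λ i a b → h i a (ℕP.m≤n⇒m≤1+n b) (λ e → ℕP.<-irrefl e (s≤s b)))) ≡-refl
... | inj₁ (s≤s j<k) = ≡-trans (≡-+ (sum-≡-two M f k j j≥1 j<k (λ i a b → h i a (ℕP.m≤n⇒m≤1+n b)))
                                    (∣ₚ⇒≡0 (h (suc k) (s≤s z≤n) ℕP.≤-refl (λ e → ℕP.<-irrefl (sym e) (s≤s j<k)))))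
                              (≈⇒≡ (+ₚ-identityʳ (f 0 +ₚ f j)))

vandermondeTerm : ℕ → ℕ → ℕ → ℕ → Poly
vandermondeTerm m n k i = (twisted m (k ∸ i) *ₚ twisted n i) *ₚ Xpow (m * i)

vandermondeTerm-0 : ∀ m n k → vandermondeTerm m n k 0 ≈ twisted m k
vandermondeTerm-0 m n k = ≈-trans (*-congʳ (twisted m k *ₚ twisted n 0) (≡⇒≈ (cong Xpow (ℕP.*-zeroʳ m))))
  (≈-trans (*-identityʳ (twisted m k *ₚ twisted n 0)) (≈-trans (*-congʳ (twisted m k) (twisted-0 n)) (*-identityʳ (twisted m k))))

vandermondeTerm-step : ∀ m n k j → vandermondeTerm m (suc n) (suc k) (suc j) ≈
  vandermondeTerm m n (suc k) (suc j) +ₚ Xpow (m + n) *ₚ vandermondeTerm m n k j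
vandermondeTerm-step m n k j = begin
  (twisted m (k ∸ j) *ₚ twisted (suc n) (suc j)) *ₚ Xpow (m * suc j)
    ≈⟨ *-cong (*-congʳ (twisted m (k ∸ j)) (twisted-pascal n j)) split-power ⟩
  (twisted m (k ∸ j) *ₚ (twisted n (suc j) +ₚ Xpow n *ₚ twisted n j)) *ₚ (Xpow m *ₚ Xpow (m * j))
    ≈⟨ expand (twisted m (k ∸ j)) (twisted n (suc j)) (Xpow n) (twisted n j) (Xpow m) (Xpow (m * j)) ⟩
  (twisted m (k ∸ j) *ₚ twisted n (suc j)) *ₚ (Xpow m *ₚ Xpow (m * j)) +ₚ (Xpow m *ₚ Xpow n) *ₚ vandermondeTerm m n k j
    ≈⟨ +-cong (*-congʳ (twisted m (k ∸ j) *ₚ twisted n (suc j)) (≈-sym split-power))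
              (*-congˡ (vandermondeTerm m n k j) (≈-sym (Xpow-+ m n))) ⟩
  vandermondeTerm m n (suc k) (suc j) +ₚ Xpow (m + n) *ₚ vandermondeTerm m n k j ∎
  where
  open ≈-Reasoning
  split-power : Xpow (m * suc j) ≈ Xpow m *ₚ Xpow (m * j)
  split-power = ≈-trans (≡⇒≈ (cong Xpow (ℕP.*-suc m j))) (Xpow-+ m (m * j))
  expand : ∀ A B Xn C Xm Y → (A *ₚ (B +ₚ Xn *ₚ C)) *ₚ (Xm *ₚ Y) ≈
                             (A *ₚ B) *ₚ (Xm *ₚ Y) +ₚ (Xm *ₚ Xn) *ₚ ((A *ₚ C) *ₚ Y)
  expand A B Xn C Xm Y = solve (A ∷ B ∷ Xn ∷ C ∷ Xm ∷ Y ∷ []) Poly-ring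

q-vandermonde : ∀ m n k → twisted (m + n) k ≈ sumUpTo (vandermondeTerm m n k) k
q-vandermonde m zero k = ≈-trans (≡⇒≈ (cong (λ z → twisted z k) (ℕP.+-identityʳ m)))
  (≈-sym (≈-trans (sum-only-first (vandermondeTerm m 0 k) k later) (vandermondeTerm-0 m 0 k)))
  where
  later : ∀ i → 1 ≤ i → i ≤ k → vandermondeTerm m 0 k i ≈ []
  later (suc i) _ _ = *-congˡ (Xpow (m * suc i))
    (≈-trans (*-congʳ (twisted m (k ∸ suc i)) (twisted-vanish 0 (suc i) (s≤s z≤n))) (*-zeroʳ (twisted m (k ∸ suc i))))
q-vandermonde m (suc n) zero = ≈-trans (≡⇒≈ (cong (λ z → twisted z 0) (ℕP.+-suc m n)))
  (≈-trans (twisted-0 (suc (m + n))) (≈-sym (≈-trans (vandermondeTerm-0 m (suc n) 0) (twisted-0 m))))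
q-vandermonde m (suc n) (suc k) = begin
  twisted (m + suc n) (suc k)
    ≈⟨ ≡⇒≈ (cong (λ z → twisted z (suc k)) (ℕP.+-suc m n)) ⟩
  twisted (suc (m + n)) (suc k)
    ≈⟨ twisted-pascal (m + n) k ⟩
  twisted (m + n) (suc k) +ₚ Xpow (m + n) *ₚ twisted (m + n) k
    ≈⟨ +-cong (q-vandermonde m n (suc k)) (*-congʳ (Xpow (m + n)) (q-vandermonde m n k)) ⟩
  sumUpTo (V (suc k)) (suc k) +ₚ Xpow (m + n) *ₚ sumUpTo (V k) k
    ≈⟨ +-cong (sum-first (V (suc k)) k) (≈-sym (sum-*ˡ (Xpow (m + n)) (V k) k)) ⟩
  (V (suc k) 0 +ₚ sumUpTo (λ j → V (suc k) (suc j)) k) +ₚ sumUpTo (λ j → Xpow (m + n) *ₚ V k j) k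
    ≈⟨ +ₚ-assoc (V (suc k) 0) _ _ ⟩
  V (suc k) 0 +ₚ (sumUpTo (λ j → V (suc k) (suc j)) k +ₚ sumUpTo (λ j → Xpow (m + n) *ₚ V k j) k)
    ≈⟨ +-cong ≈-refl (≈-sym (sum-+ (λ j → V (suc k) (suc j)) (λ j → Xpow (m + n) *ₚ V k j) k)) ⟩
  V (suc k) 0 +ₚ sumUpTo (λ j → V (suc k) (suc j) +ₚ Xpow (m + n) *ₚ V k j) k
    ≈⟨ +-cong ≈-refl (sum-cong _ _ k (λ j _ → ≈-sym (vandermondeTerm-step m n k j))) ⟩
  V′ 0 +ₚ sumUpTo (λ j → V′ (suc j)) k
    ≈⟨ ≈-sym (sum-first V′ k) ⟩
  sumUpTo V′ (suc k) ∎
  where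
  open ≈-Reasoning
  V : ℕ → ℕ → Poly
  V = vandermondeTerm m n
  V′ : ℕ → Poly
  V′ = vandermondeTerm m (suc n) (suc k)

altTerm : ℕ → ℕ → Poly
altTerm m k = constₚ (-1ℤ ℤ.^ k) *ₚ twisted m k

altSum : ℕ → Poly
altSum m = sumUpTo (altTerm m) (suc m)

const-sign-suc : ∀ k → constₚ (-1ℤ ℤ.^ suc k) ≈ negₚ (constₚ (-1ℤ ℤ.^ k))
const-sign-suc k = ∷-cong (ℤP.-1*i≡-i (-1ℤ ℤ.^ k)) ≈-refl

altSum-step : ∀ m → altSum (suc m) ≈ altSum m +ₚ negₚ (Xpow m *ₚ altSum m)
altSum-step m = begin
  sumUpTo (altTerm (suc m)) (suc (suc m))
    ≈⟨ sum-first (altTerm (suc m)) (suc m) ⟩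
  altTerm m 0 +ₚ sumUpTo (λ j → altTerm (suc m) (suc j)) (suc m)
    ≈⟨ +-cong (≈-refl {altTerm m 0}) (sum-cong _ _ (suc m) (λ j _ → term-step j)) ⟩
  altTerm m 0 +ₚ sumUpTo (λ j → altTerm m (suc j) +ₚ negₚ (Xpow m *ₚ altTerm m j)) (suc m)
    ≈⟨ +-cong (≈-refl {altTerm m 0}) (sum-+ (λ j → altTerm m (suc j)) (λ j → negₚ (Xpow m *ₚ altTerm m j)) (suc m)) ⟩
  altTerm m 0 +ₚ (sumUpTo (λ j → altTerm m (suc j)) (suc m) +ₚ sumUpTo (λ j → negₚ (Xpow m *ₚ altTerm m j)) (suc m))
    ≈⟨ ≈-sym (+ₚ-assoc (altTerm m 0) (sumUpTo (λ j → altTerm m (suc j)) (suc m))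
                       (sumUpTo (λ j → negₚ (Xpow m *ₚ altTerm m j)) (suc m))) ⟩
  (altTerm m 0 +ₚ sumUpTo (λ j → altTerm m (suc j)) (suc m)) +ₚ sumUpTo (λ j → negₚ (Xpow m *ₚ altTerm m j)) (suc m)
    ≈⟨ +-cong (≈-sym (sum-first (altTerm m) (suc m)))
              (≈-trans (sum-neg (λ j → Xpow m *ₚ altTerm m j) (suc m)) (neg-cong (sum-*ˡ (Xpow m) (altTerm m) (suc m)))) ⟩
  (altSum m +ₚ altTerm m (suc (suc m))) +ₚ negₚ (Xpow m *ₚ altSum m)
    ≈⟨ +-cong (≈-trans (+-cong (≈-refl {altSum m}) last-vanishes) (+ₚ-identityʳ (altSum m))) ≈-refl ⟩
  altSum m +ₚ negₚ (Xpow m *ₚ altSum m) ∎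
  where
  open ≈-Reasoning
  term-step : ∀ j → altTerm (suc m) (suc j) ≈ altTerm m (suc j) +ₚ negₚ (Xpow m *ₚ altTerm m j)
  term-step j = ≈-trans (*-congʳ sign (twisted-pascal m j)) (≈-trans (*-distribˡ sign (twisted m (suc j)) (Xpow m *ₚ twisted m j))
    (+-cong (≈-refl {altTerm m (suc j)}) (≈-trans (*-congˡ (Xpow m *ₚ twisted m j) (const-sign-suc j))
                                                   (lemma (constₚ (-1ℤ ℤ.^ j)) (Xpow m) (twisted m j)))))
    where
    sign : Poly
    sign = constₚ (-1ℤ ℤ.^ suc j)
    lemma : ∀ a x y → negₚ a *ₚ (x *ₚ y) ≈ negₚ (x *ₚ (a *ₚ y))
    lemma a x y = solve (a ∷ x ∷ y ∷ []) Poly-ring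
  last-vanishes : altTerm m (suc (suc m)) ≈ []
  last-vanishes = ≈-trans (*-congʳ (constₚ (-1ℤ ℤ.^ suc (suc m))) (twisted-vanish m (suc (suc m)) (ℕP.m≤n⇒m≤1+n ℕP.≤-refl)))
                          (*-zeroʳ (constₚ (-1ℤ ℤ.^ suc (suc m))))

-- Hence altSum m = 0 for m ≥ 1, as altSum 0 = 1 and 1 - q^0 = 0.
altSum-vanish : ∀ m → altSum (suc m) ≈ []
altSum-vanish zero    = ≈-trans (altSum-step 0)
  (≈-trans (+-cong altSum-0 (neg-cong (≈-trans (*-identityˡ (altSum 0)) altSum-0))) (+ₚ-inverseʳ 𝟙))
  where
  altSum-0 : altSum 0 ≈ 𝟙
  altSum-0 = mk≈ λ { zero → refl ; (suc zero) → refl ; (suc (suc i)) → refl }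
altSum-vanish (suc m) = ≈-trans (altSum-step (suc m)) (+-cong (altSum-vanish m)
  (neg-cong (≈-trans (*-congʳ (Xpow (suc m)) (altSum-vanish m)) (*-zeroʳ (Xpow (suc m))))))

lastPoly-snoc : ∀ l x → lastPoly (l ++ x ∷ []) ≡ x
lastPoly-snoc []          x = refl
lastPoly-snoc (a ∷ [])    x = refl
lastPoly-snoc (a ∷ b ∷ l) x = lastPoly-snoc (b ∷ l) x

cycList-length : ∀ n → length (cycList n) ≡ n
cycList-length zero    = refl
cycList-length (suc n) = trans (LP.length-++ (cycList n))
  (trans (ℕP.+-comm (length (cycList n)) 1) (cong suc (cycList-length n)))

divisorFactor : ℕ → ℕ → Poly → Poly
divisorFactor m d φ = if does (d ∣? m) then φ else 𝟙

divisorFactor-cong : ∀ m d {φ ψ} → φ ≈ ψ → divisorFactor m d φ ≈ divisorFactor m d ψ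
divisorFactor-cong m d e with d ∣? m
... | yes _ = e
... | no  _ = ≈-refl

divisorFactor-∣ : ∀ {m d} φ → d ∣ m → divisorFactor m d φ ≈ φ
divisorFactor-∣ {m} {d} φ p with d ∣? m
... | yes _ = ≈-refl
... | no ¬p = ⊥-elim (¬p p)

divisorFactor-∤ : ∀ {m d} φ → ¬ (d ∣ m) → divisorFactor m d φ ≈ 𝟙
divisorFactor-∤ {m} {d} φ ¬p with d ∣? m
... | yes p = ⊥-elim (¬p p)
... | no  _ = ≈-refl

cycProd : ℕ → ℕ → Poly
cycProd m zero    = 𝟙
cycProd m (suc k) = cycProd m k *ₚ divisorFactor m (suc k) (Φ (suc k))

cycProd-∣-step : ∀ {m k} → suc k ∣ m → cycProd m (suc k) ≈ cycProd m k *ₚ Φ (suc k)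
cycProd-∣-step {m} {k} p = *-congʳ (cycProd m k) (divisorFactor-∣ (Φ (suc k)) p)

cycProd-∤-step : ∀ {m k} → ¬ (suc k ∣ m) → cycProd m (suc k) ≈ cycProd m k
cycProd-∤-step {m} {k} ¬p =
  ≈-trans (*-congʳ (cycProd m k) (divisorFactor-∤ (Φ (suc k)) ¬p)) (*-identityʳ (cycProd m k))

rawΦ : ℕ → Poly
rawΦ n = divMonic (Xpow-1 (suc n)) (prodDivs (suc n) 1 (cycList n))

Φ≈rawΦ : ∀ n → Φ (suc n) ≈ rawΦ n
Φ≈rawΦ n = ≈-trans (normalize≈ (lastPoly (cycList (suc n)))) (≡⇒≈ (lastPoly-snoc (cycList n) (rawΦ n)))

prodDivs-snoc : ∀ m d l x → prodDivs m d (l ++ x ∷ []) ≈ prodDivs m d l *ₚ divisorFactor m (d + length l) x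
prodDivs-snoc m d []      x = ≈-trans (*-identityʳ (divisorFactor m d x))
  (≈-trans (≡⇒≈ (cong (λ z → divisorFactor m z x) (sym (ℕP.+-identityʳ d)))) (≈-sym (*-identityˡ (divisorFactor m (d + 0) x))))
prodDivs-snoc m d (a ∷ l) x = ≈-trans (*-congʳ (divisorFactor m d a) (prodDivs-snoc m (suc d) l x))
  (≈-trans (≈-sym (*-assoc (divisorFactor m d a) (prodDivs m (suc d) l) (divisorFactor m (suc d + length l) x)))
           (*-congʳ (divisorFactor m d a *ₚ prodDivs m (suc d) l)
                    (≡⇒≈ (cong (λ z → divisorFactor m z x) (sym (ℕP.+-suc d (length l)))))))

prodDivs≈cycProd : ∀ m n → prodDivs m 1 (cycList n) ≈ cycProd m n
prodDivs≈cycProd m zero    = ≈-refl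
prodDivs≈cycProd m (suc n) = ≈-trans (prodDivs-snoc m 1 (cycList n) (rawΦ n))
  (*-cong (prodDivs≈cycProd m n)
          (≈-trans (≡⇒≈ (cong (λ z → divisorFactor m (suc z) (rawΦ n)) (cycList-length n)))
                   (divisorFactor-cong m (suc n) (≈-sym (Φ≈rawΦ n)))))

Φ-exact : ∀ n Q → MonicSome (cycProd (suc n) n) → Xpow-1 (suc n) ≈ Q *ₚ cycProd (suc n) n → Φ (suc n) ≈ Q
Φ-exact n Q (e , monic) h = ≈-trans (Φ≈rawΦ n)
  (divMonic-exact (Xpow-1 (suc n)) (prodDivs (suc n) 1 (cycList n)) Q (Monic-≈ (≈-sym (prodDivs≈cycProd (suc n) n)) monic)
                  (≈-trans h (*-congʳ Q (≈-sym (prodDivs≈cycProd (suc n) n)))))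

cycProd-monic : ∀ m k → (∀ d → 1 ≤ d → d ≤ k → d ∣ m → MonicSome (Φ d)) → MonicSome (cycProd m k)
cycProd-monic m zero    h = 0 , 𝟙-monic
cycProd-monic m (suc k) h with suc k ∣? m
... | yes p = let (e , me) = cycProd-monic m k (λ d a b → h d a (ℕP.m≤n⇒m≤1+n b))
                  (e′ , me′) = h (suc k) (s≤s z≤n) ℕP.≤-refl p in
  e + e′ , Monic-≈ (≈-sym (cycProd-∣-step p)) (Monic-* (cycProd m k) (Φ (suc k)) me me′)
... | no ¬p = let (e , me) = cycProd-monic m k (λ d a b → h d a (ℕP.m≤n⇒m≤1+n b)) in
  e , Monic-≈ (≈-sym (cycProd-∤-step ¬p)) me

cycProd-∣ : ∀ a b k → (∀ d → d ∣ a → d ∣ b) → cycProd a k ∣ₚ cycProd b k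
cycProd-∣ a b zero    h = ∣ₚ-refl 𝟙
cycProd-∣ a b (suc k) h with cycProd-∣ a b k h | suc k ∣? a | suc k ∣? b
... | dvd | yes pa | yes pb = ∣ₚ-respˡ (≈-sym (cycProd-∣-step pa))
  (∣ₚ-respʳ (≈-sym (cycProd-∣-step pb)) (∣ₚ-* dvd (∣ₚ-refl (Φ (suc k)))))
... | dvd | yes pa | no ¬pb = ⊥-elim (¬pb (h (suc k) pa))
... | dvd | no ¬pa | yes pb = ∣ₚ-respˡ (≈-sym (cycProd-∤-step ¬pa))
  (∣ₚ-respʳ (≈-sym (cycProd-∣-step pb)) (∣ₚ-*ʳ (Φ (suc k)) dvd))
... | dvd | no ¬pa | no ¬pb = ∣ₚ-respˡ (≈-sym (cycProd-∤-step ¬pa)) (∣ₚ-respʳ (≈-sym (cycProd-∤-step ¬pb)) dvd)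

cycProd-beyond : ∀ g k → 1 ≤ g → g ≤ k → cycProd g k ≈ cycProd g g
cycProd-beyond g k g≥1 g≤k with ℕP.m≤n⇒m<n∨m≡n g≤k
... | inj₂ refl = ≈-refl
cycProd-beyond (suc g) (suc k) g≥1 g≤k | inj₁ (s≤s g<k) =
  ≈-trans (cycProd-∤-step (λ p → ℕP.<⇒≱ (s≤s g<k) (∣⇒≤ p))) (cycProd-beyond (suc g) k g≥1 g<k)

positive-divisor : ∀ {g x} → g ∣ suc x → 1 ≤ g
positive-divisor {zero}  g∣x with () ← 0∣⇒≡0 g∣x
positive-divisor {suc g} _ = s≤s z≤n

record Cyclotomic (N : ℕ) : Set where
  field
    factorisation : Xpow-1 N ≈ cycProd N N
    Φ-monic       : MonicSome (Φ N)
open Cyclotomic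

Φ-∣-Xpow-1 : ∀ {d} → Cyclotomic (suc d) → Φ (suc d) ∣ₚ Xpow-1 (suc d)
Φ-∣-Xpow-1 {d} c = dividesₚ (cycProd (suc d) d) (≈-trans (factorisation c) (cycProd-∣-step (∣-refl {suc d})))

Comaximal : Poly → Poly → Set
Comaximal A B = Σ ℕ λ c → InIdeal A B (natₚ (suc c))

Comaximal-respʳ : ∀ {A B B'} → B ≈ B' → Comaximal A B → Comaximal A B'
Comaximal-respʳ e (c , i) = c , InIdeal-respʳ e i

Comaximal-*ʳ : ∀ {A B C} → Comaximal A B → Comaximal A C → Comaximal A (B *ₚ C)
Comaximal-*ʳ (c₁ , i₁) (c₂ , i₂) = c₂ + c₁ * suc c₂ , InIdeal-resp (natₚ-* (suc c₁) (suc c₂)) (InIdeal-*-right i₁ i₂)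

∣ₚ-coprime-cancel : ∀ {e P E G} → Comaximal P E → Monic e P → P ∣ₚ E *ₚ G → P ∣ₚ G
∣ₚ-coprime-cancel {P = P} {E} {G} (c , u , v , h) mP dvd = ∣ₚ-cancel-nat c mP
  (∣ₚ-respʳ (≈-sym (≈-trans (*-congˡ G h) (lemma u v P E G))) (∣ₚ-+ (dividesₚ (u *ₚ G) ≈-refl) (∣ₚ-*ˡ v dvd)))
  where
  lemma : ∀ u v P E G → (u *ₚ P +ₚ v *ₚ E) *ₚ G ≈ (u *ₚ G) *ₚ P +ₚ v *ₚ (E *ₚ G)
  lemma u v P E G = solve (u ∷ v ∷ P ∷ E ∷ G ∷ []) Poly-ring

private
  move-integer : ∀ a b h → a +ₚ negₚ b ≈ h → b ≈ a +ₚ negₚ h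
  move-integer a b h e = ≈-trans (rearrange a b) (+-cong (≈-refl {a}) (neg-cong e))
    where
    rearrange : ∀ a b → b ≈ a +ₚ negₚ (a +ₚ negₚ b)
    rearrange a b = solve (a ∷ b ∷ []) Poly-ring

  rearrange-WΦ : ∀ W P M → (W *ₚ P) *ₚ M ≈ (M *ₚ W) *ₚ P
  rearrange-WΦ W P M = solve (W ∷ P ∷ M ∷ []) Poly-ring

-- If an ideal contains Φ_x and q^g - 1 for a proper divisor g = x/m of x, it contains m:
-- q^x - 1 = (q^g - 1)·W·Φ_x = (q^g - 1)·geom g m, so W·Φ_x = geom g m ≡ m (mod q^g - 1).
proper-divisor-integer : ∀ {A B x g} → Cyclotomic x → Cyclotomic g → 1 ≤ x → g ∣ x → g ≢ x →
  InIdeal A B (Φ x) → InIdeal A B (Xpow-1 g) → Comaximal A B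
proper-divisor-integer {x = suc x′} {zero} _ _ _ g∣x _ _ _ with () ← 0∣⇒≡0 g∣x
proper-divisor-integer {x = suc x′} {suc g′} cx cg _ (divides zero ()) _ _ _
proper-divisor-integer {A} {B} {suc x′} {suc g′} cx cg _ g∣x@(divides (suc c) x≡) g≢x iΦ iX =
  c , InIdeal-resp (≈-sym integer) (InIdeal-+ (InIdeal-* W iΦ) (InIdeal-neg (InIdeal-* H iX)))
  where
  x : ℕ
  x = suc x′
  g : ℕ
  g = suc g′
  g≤x′ : g ≤ x′
  g≤x′ with ℕP.m≤n⇒m<n∨m≡n (∣⇒≤ g∣x)
  ... | inj₁ (s≤s lt) = lt
  ... | inj₂ eq       = ⊥-elim (g≢x eq)
  products : cycProd g x′ ∣ₚ cycProd x x′
  products = cycProd-∣ g x x′ (λ d d∣g → ∣-trans d∣g g∣x)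
  W : Poly
  W = quotient products
  via-Φ : Xpow-1 x ≈ (Xpow-1 g *ₚ W) *ₚ Φ x
  via-Φ = ≈-trans (factorisation cx) (≈-trans (cycProd-∣-step (∣-refl {x})) (*-congˡ (Φ x)
    (≈-trans (equation products) (≈-trans (*-congʳ W (≈-trans (cycProd-beyond g x′ (s≤s z≤n) g≤x′) (≈-sym (factorisation cg))))
                                          (*-comm W (Xpow-1 g))))))
  via-geom : Xpow-1 x ≈ Xpow-1 g *ₚ geom g (suc c)
  via-geom = ≈-trans (≡⇒≈ (cong Xpow-1 x≡)) (≈-sym (geom-sum g (suc c)))
  WΦ≈geom : W *ₚ Φ x ≈ geom g (suc c)
  WΦ≈geom = monic-cancel (W *ₚ Φ x) (geom g (suc c)) (Xpow-1-monic g′)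
    (≈-trans (rearrange-WΦ W (Φ x) (Xpow-1 g)) (≈-trans (≈-sym via-Φ) (≈-trans via-geom (*-comm (Xpow-1 g) (geom g (suc c))))))
  mod-g : Xpow-1 g ∣ₚ geom g (suc c) -ₚ natₚ (suc c)
  mod-g = difference (geom-≡-nat g (suc c))
  H : Poly
  H = quotient mod-g
  integer : natₚ (suc c) ≈ W *ₚ Φ x +ₚ negₚ (H *ₚ Xpow-1 g)
  integer = ≈-trans (move-integer (geom g (suc c)) (natₚ (suc c)) (H *ₚ Xpow-1 g) (equation mod-g))
                    (+-cong (≈-sym WΦ≈geom) ≈-refl)

module CyclotomicStep (n : ℕ) (IH : ∀ d → 1 ≤ d → d ≤ n → Cyclotomic d) where

  N : ℕ
  N = suc n

  -- Distinct Φ_d, Φ_d′ (d, d′ ≤ n) are comaximal: Euclid's algorithm puts q^g - 1 in their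
  -- ideal for a common divisor g, which is a proper divisor of d or of d′.
  Φ-comaximal : ∀ d d′ → 1 ≤ d → d ≤ n → 1 ≤ d′ → d′ ≤ n → d ≢ d′ → Comaximal (Φ d) (Φ d′)
  Φ-comaximal (suc d) (suc d′) _ d≤n _ d′≤n d≢d′ =
    conclude (euclid (suc (suc d + suc d′)) (suc d) (suc d′) ℕP.≤-refl
                     (InIdeal-left (Φ-∣-Xpow-1 (IH _ (s≤s z≤n) d≤n))) (InIdeal-right (Φ-∣-Xpow-1 (IH _ (s≤s z≤n) d′≤n))))
             (suc d ∣? suc d′)
    where
    conclude : CommonExponent (Φ (suc d)) (Φ (suc d′)) (suc d) (suc d′) → Dec (suc d ∣ suc d′) →
               Comaximal (Φ (suc d)) (Φ (suc d′))
    conclude (common g g∣d g∣d′ i) (no d∤d′) =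
      proper-divisor-integer (IH _ (s≤s z≤n) d≤n) (IH g (positive-divisor g∣d) (ℕP.≤-trans (∣⇒≤ g∣d) d≤n)) (s≤s z≤n) g∣d
                             (λ { refl → d∤d′ g∣d′ }) (InIdeal-left (∣ₚ-refl (Φ (suc d)))) i
    conclude (common g g∣d g∣d′ i) (yes d∣d′) =
      proper-divisor-integer (IH _ (s≤s z≤n) d′≤n) (IH g (positive-divisor g∣d′) (ℕP.≤-trans (∣⇒≤ g∣d′) d′≤n)) (s≤s z≤n) g∣d′
                             (λ { refl → d≢d′ (∣-antisym d∣d′ g∣d) }) (InIdeal-right (∣ₚ-refl (Φ (suc d′)))) i

  Φ-comaximal-cycProd : ∀ d k → 1 ≤ d → d ≤ n → k < d → Comaximal (Φ d) (cycProd N k)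
  Φ-comaximal-cycProd d zero    _   _   _   = 0 , InIdeal-right (∣ₚ-refl 𝟙)
  Φ-comaximal-cycProd d (suc k) d≥1 d≤n k<d with suc k ∣? N
  ... | no ¬p = Comaximal-respʳ (≈-sym (cycProd-∤-step ¬p)) (Φ-comaximal-cycProd d k d≥1 d≤n (ℕP.<-trans (ℕP.n<1+n k) k<d))
  ... | yes p = Comaximal-respʳ (≈-sym (cycProd-∣-step p))
    (Comaximal-*ʳ (Φ-comaximal-cycProd d k d≥1 d≤n (ℕP.<-trans (ℕP.n<1+n k) k<d))
                  (Φ-comaximal d (suc k) d≥1 d≤n (s≤s z≤n) (ℕP.≤-trans (ℕP.<⇒≤ k<d) d≤n)
                               (λ { refl → ℕP.<-irrefl refl k<d })))

  -- Every partial product cycProd N k (k ≤ n) divides q^N - 1: adjoin one Φ_d at a time,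
  -- using comaximality of Φ_d with the product so far.
  cycProd-∣-Xpow-1 : ∀ k → k ≤ n → cycProd N k ∣ₚ Xpow-1 N
  cycProd-∣-Xpow-1 zero    _ = dividesₚ (Xpow-1 N) (≈-sym (*-identityʳ (Xpow-1 N)))
  cycProd-∣-Xpow-1 (suc k) k<n with cycProd-∣-Xpow-1 k (ℕP.<⇒≤ k<n) | suc k ∣? N
  ... | dvd | no ¬p = ∣ₚ-respˡ (≈-sym (cycProd-∤-step ¬p)) dvd
  ... | dividesₚ Q hQ | yes p = adjoin Q hQ p
    where
    adjoin : ∀ Q → Xpow-1 N ≈ Q *ₚ cycProd N k → suc k ∣ N → cycProd N (suc k) ∣ₚ Xpow-1 N
    adjoin Q hQ p = dividesₚ (quotient Φ∣Q) (≈-trans hQ (≈-trans (*-congˡ (cycProd N k) (equation Φ∣Q))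
      (≈-trans (*-assoc (quotient Φ∣Q) (Φ (suc k)) (cycProd N k))
               (*-congʳ (quotient Φ∣Q) (≈-trans (*-comm (Φ (suc k)) (cycProd N k)) (≈-sym (cycProd-∣-step p)))))))
      where
      cyc : Cyclotomic (suc k)
      cyc = IH (suc k) (s≤s z≤n) k<n
      Φ∣X : Φ (suc k) ∣ₚ cycProd N k *ₚ Q
      Φ∣X = ∣ₚ-respʳ (≈-trans hQ (*-comm Q (cycProd N k))) (∣ₚ-trans (Φ-∣-Xpow-1 cyc) (Xpow-1-∣ p))
      Φ∣Q : Φ (suc k) ∣ₚ Q
      Φ∣Q = ∣ₚ-coprime-cancel (Φ-comaximal-cycProd (suc k) k (s≤s z≤n) k<n ℕP.≤-refl) (proj₂ (Φ-monic cyc)) Φ∣X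

  -- q^N - 1 = Q · cycProd N n, so Φ_N ≈ Q; the factorisation and monicity follow.
  cyclotomic-suc : Cyclotomic N
  cyclotomic-suc = record
    { factorisation = ≈-trans (equation dvd) (≈-trans (*-congˡ E (≈-sym ΦQ))
                              (≈-trans (*-comm (Φ N) E) (≈-sym (cycProd-∣-step (∣-refl {N})))))
    ; Φ-monic = monic-quotient (Φ N) E-monic (suc n , Xpow-1-monic n) (≈-trans (*-congˡ E ΦQ) (≈-sym (equation dvd)))
    }
    where
    E : Poly
    E = cycProd N n
    E-monic : MonicSome E
    E-monic = cycProd-monic N n (λ d a b _ → Φ-monic (IH d a b))
    dvd : E ∣ₚ Xpow-1 N
    dvd = cycProd-∣-Xpow-1 n ℕP.≤-refl
    ΦQ : Φ N ≈ quotient dvd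
    ΦQ = Φ-exact n (quotient dvd) E-monic (equation dvd)

cyclotomic : ∀ N → 1 ≤ N → Cyclotomic N
cyclotomic N N≥1 = below N N N≥1 ℕP.≤-refl
  where
  below : ∀ n d → 1 ≤ d → d ≤ n → Cyclotomic d
  below zero    zero () _
  below (suc n) d d≥1 d≤n with ℕP.m≤n⇒m<n∨m≡n d≤n
  ... | inj₁ (s≤s d≤n′) = below n d d≥1 d≤n′
  ... | inj₂ refl       = CyclotomicStep.cyclotomic-suc n (below n)

-- For 0 < i < n, Φ_n and q^i - 1 are comaximal: Euclid puts q^g - 1 in their ideal for some
-- g ∣ n with g ≤ i, a proper divisor of n.
Φ-comaximal-Xpow-1 : ∀ n i → 1 ≤ i → i < n → Comaximal (Φ n) (Xpow-1 i)
Φ-comaximal-Xpow-1 (suc n′) (suc i′) _ i<n =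
  conclude (euclid (suc (suc n′ + suc i′)) (suc n′) (suc i′) ℕP.≤-refl
                   (InIdeal-left (Φ-∣-Xpow-1 cyc)) (InIdeal-right (∣ₚ-refl (Xpow-1 (suc i′)))))
  where
  cyc : Cyclotomic (suc n′)
  cyc = cyclotomic (suc n′) (s≤s z≤n)
  conclude : CommonExponent (Φ (suc n′)) (Xpow-1 (suc i′)) (suc n′) (suc i′) → Comaximal (Φ (suc n′)) (Xpow-1 (suc i′))
  conclude (common g g∣n g∣i inI) = proper-divisor-integer cyc (cyclotomic g (positive-divisor g∣n)) (s≤s z≤n) g∣n
    (λ { refl → ℕP.<-irrefl refl (ℕP.≤-<-trans (∣⇒≤ g∣i) i<n) }) (InIdeal-left (∣ₚ-refl (Φ (suc n′)))) inI

-- Φ_n divides qbin n i for 0 < i < n, because (q^i - 1) qbin n i = (q^n - 1) qbin (n-1) (i-1).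
Φ-∣-qbin : ∀ n i → 1 ≤ i → i < n → Φ n ∣ₚ qbin n i
Φ-∣-qbin (suc n′) (suc i′) i≥1 (s≤s i′<n′) =
  ∣ₚ-coprime-cancel (Φ-comaximal-Xpow-1 (suc n′) (suc i′) i≥1 (s≤s i′<n′)) (proj₂ (Φ-monic cyc))
    (∣ₚ-respʳ (≈-sym (qbin-absorb n′ i′ (ℕP.<⇒≤ i′<n′))) (∣ₚ-*ʳ (qbin n′ i′) (Φ-∣-Xpow-1 cyc)))
  where
  cyc : Cyclotomic (suc n′)
  cyc = cyclotomic (suc n′) (s≤s z≤n)

Φ-∣-twisted : ∀ n i → 1 ≤ i → i < n → Φ n ∣ₚ twisted n i
Φ-∣-twisted n i i≥1 i<n = ∣ₚ-*ˡ (Xpow (choose2 i)) (Φ-∣-qbin n i i≥1 i<n)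

twist : ℕ → Poly
twist n = constₚ (σ n) *ₚ Xpow (choose2 n)

≡0⇒≡ : ∀ {M x y} → x -ₚ y ≡[ M ] [] → x ≡[ M ] y
≡0⇒≡ {x = x} {y} (congruent d) = congruent (∣ₚ-respʳ (+ₚ-identityʳ (x -ₚ y)) d)

-- The vanishing alternating sum Σ (-1)^k twisted n k reduces modulo Φ_n to its terms k = 0
-- and k = n, that is 1 - σ_n q^(n choose 2) ≡ 0.
twist≡1 : ∀ n′ → twist (suc n′) ≡[ Φ (suc n′) ] 𝟙
twist≡1 n′ = ≡-sym (≡0⇒≡ (≡-trans (≈⇒≡ (≈-sym (+-cong first last)))
                                  (≡-trans (≡-sym two-terms) (≈⇒≡ (altSum-vanish n′)))))
  where
  n : ℕ
  n = suc n′
  first : altTerm n 0 ≈ 𝟙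
  first = ≈-trans (*-identityˡ (twisted n 0)) (twisted-0 n)
  last : altTerm n n ≈ negₚ (twist n)
  last = ≈-trans (*-cong (const-sign-suc n′) (twisted-diag n)) (lemma (constₚ (σ n)) (Xpow (choose2 n)))
    where
    lemma : ∀ a x → negₚ a *ₚ x ≈ negₚ (a *ₚ x)
    lemma a x = solve (a ∷ x ∷ []) Poly-ring
  others : ∀ i → 1 ≤ i → i ≤ suc n → i ≢ n → Φ n ∣ₚ altTerm n i
  others i i≥1 _ i≢n with ℕP.<-cmp i n
  ... | tri< i<n _ _ = ∣ₚ-*ˡ (constₚ (-1ℤ ℤ.^ i)) (Φ-∣-twisted n i i≥1 i<n)
  ... | tri≈ _ i≡n _ = ⊥-elim (i≢n i≡n)
  ... | tri> _ _ i>n = ∣ₚ-zero (≈-trans (*-congʳ (constₚ (-1ℤ ℤ.^ i)) (twisted-vanish n i i>n)) (*-zeroʳ (constₚ (-1ℤ ℤ.^ i))))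
  two-terms : altSum n ≡[ Φ n ] altTerm n 0 +ₚ altTerm n n
  two-terms = sum-≡-two (Φ n) (altTerm n) (suc n) n (s≤s z≤n) (ℕP.n≤1+n n) others

Xpow-multiple≡1 : ∀ n′ m → Xpow (m * suc n′) ≡[ Φ (suc n′) ] 𝟙
Xpow-multiple≡1 n′ m = congruent (∣ₚ-trans (Φ-∣-Xpow-1 (cyclotomic (suc n′) (s≤s z≤n))) (Xpow-1-∣ (divides m refl)))

choose2-+ : ∀ x y → choose2 (x + y) ≡ choose2 x + choose2 y + x * y
choose2-+ zero    y = sym (ℕP.+-identityʳ (choose2 y))
choose2-+ (suc x) y = trans (cong (_+ (x + y)) (choose2-+ x y)) (rearrange (choose2 x) (choose2 y) (x * y) x y)
  where
  rearrange : ∀ a b c x y → a + b + c + (x + y) ≡ a + x + b + (y + c)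
  rearrange = ℕS.solve-∀

choose2≡C2 : ∀ m → choose2 m ≡ m C 2
choose2≡C2 zero    = sym (k>n⇒nCk≡0 {0} {2} (s≤s z≤n))
choose2≡C2 (suc m) = trans (cong₂ _+_ (choose2≡C2 m) (sym (nC1≡n m)))
                           (trans (ℕP.+-comm (m C 2) (m C 1)) (nCk+nC[k+1]≡[n+1]C[k+1] m 1))

natₚ-C-0 : ∀ a → natₚ (a C 0) ≈ 𝟙
natₚ-C-0 a = ≡⇒≈ (cong natₚ (trans (nCk≡nC[n∸k] {0} {a} z≤n) (nCn≡1 a)))

natₚ-C-beyond : ∀ a → natₚ (a C suc a) ≈ []
natₚ-C-beyond a = ≈-trans (≡⇒≈ (cong natₚ (k>n⇒nCk≡0 (ℕP.n<1+n a)))) const-0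

∤-sub-small : ∀ {n k i} → n ∣ k → 1 ≤ i → i < n → i ≤ k → ¬ (n ∣ k ∸ i)
∤-sub-small {n} {k} {suc i} n∣k _ i<n i≤k n∣k-i =
  ℕP.<⇒≱ i<n (∣⇒≤ (∣m+n∣m⇒∣n (subst (n ∣_) (sym (ℕP.m∸n+n≡m i≤k)) n∣k) n∣k-i))

∤-sub-n : ∀ {n k} → n ≤ k → ¬ (n ∣ k) → ¬ (n ∣ k ∸ n)
∤-sub-n {n} n≤k n∤k n∣k-n = n∤k (subst (n ∣_) (ℕP.m∸n+n≡m n≤k) (∣m∣n⇒∣m+n n∣k-n ∣-refl))

module ModuloΦ² (n′ : ℕ) where

  n : ℕ
  n = suc n′
  P : Poly
  P = Φ n
  P² : Poly
  P² = P *ₚ P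

  ratio : ℕ → Poly
  ratio A = twist n *ₚ Xpow ((A * n) * n)

  ratio≡1 : ∀ A → ratio A ≡[ P ] 𝟙
  ratio≡1 A = ≡-trans (≡-* (twist≡1 n′) (Xpow-multiple≡1 n′ (A * n))) (≈⇒≡ (*-identityˡ 𝟙))

  signedPower : ℕ → Poly
  signedPower A = constₚ (σ n ℤ.^ A) *ₚ Xpow (choose2 (A * n))

  -- signedPower (A+1) = signedPower A · ratio A, since
  -- ((n + An) choose 2) = (n choose 2) + (An choose 2) + An·n.
  signedPower-suc : ∀ A → signedPower (suc A) ≈ signedPower A *ₚ ratio A
  signedPower-suc A =
    ≈-trans (*-cong (≈-trans (∷-cong (ℤP.*-comm (σ n) (σ n ℤ.^ A)) ≈-refl) (const-* (σ n ℤ.^ A) (σ n))) exponents)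
    (rearrange (constₚ (σ n ℤ.^ A)) (constₚ (σ n)) (Xpow (choose2 (A * n))) (Xpow (choose2 n)) (Xpow ((A * n) * n)))
    where
    rearrange : ∀ a s x t y → (a *ₚ s) *ₚ ((t *ₚ x) *ₚ y) ≈ (a *ₚ x) *ₚ ((s *ₚ t) *ₚ y)
    rearrange a s x t y = solve (a ∷ s ∷ x ∷ t ∷ y ∷ []) Poly-ring
    exponents : Xpow (choose2 (n + A * n)) ≈ (Xpow (choose2 n) *ₚ Xpow (choose2 (A * n))) *ₚ Xpow ((A * n) * n)
    exponents = ≈-trans (≡⇒≈ (cong Xpow (trans (choose2-+ n (A * n))
                                               (cong (λ z → choose2 n + choose2 (A * n) + z) (ℕP.*-comm n (A * n))))))
                        (≈-trans (Xpow-+ (choose2 n + choose2 (A * n)) ((A * n) * n))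
                                 (*-congˡ (Xpow ((A * n) * n)) (Xpow-+ (choose2 n) (choose2 (A * n)))))

  signedPower≡1 : ∀ A → signedPower A ≡[ P ] 𝟙
  signedPower≡1 zero    = ≈⇒≡ (*-identityˡ 𝟙)
  signedPower≡1 (suc A) = ≡-trans (≈⇒≡ (signedPower-suc A))
    (≡-trans (≡-* (signedPower≡1 A) (ratio≡1 A)) (≈⇒≡ (*-identityˡ 𝟙)))

  vandermonde-multiple : ∀ A k → twisted (suc A * n) k ≈ sumUpTo (vandermondeTerm (A * n) n k) k
  vandermonde-multiple A k = ≈-trans (≡⇒≈ (cong (λ z → twisted z k) (ℕP.+-comm n (A * n)))) (q-vandermonde (A * n) n k)

  vandermondeTerm-beyond : ∀ m k i → n < i → vandermondeTerm m n k i ≈ []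
  vandermondeTerm-beyond m k i n<i = *-congˡ (Xpow (m * i))
    (≈-trans (*-congʳ (twisted m (k ∸ i)) (twisted-vanish n i n<i)) (*-zeroʳ (twisted m (k ∸ i))))

  Φ-∣-twisted-multiple : ∀ a k → ¬ (n ∣ k) → P ∣ₚ twisted (a * n) k
  Φ-∣-twisted-multiple zero    zero    n∤k = ⊥-elim (n∤k (n ∣0))
  Φ-∣-twisted-multiple zero    (suc k) _   = ∣ₚ-zero (twisted-vanish 0 (suc k) (s≤s z≤n))
  Φ-∣-twisted-multiple (suc a) k       n∤k =
    ∣ₚ-respʳ (≈-sym (vandermonde-multiple a k)) (sum-∣ P (vandermondeTerm (a * n) n k) k term)
    where
    term : ∀ i → i ≤ k → P ∣ₚ vandermondeTerm (a * n) n k i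
    term zero    _   = ∣ₚ-*ʳ (Xpow (a * n * 0)) (∣ₚ-*ʳ (twisted n 0) (Φ-∣-twisted-multiple a k n∤k))
    term (suc i) i≤k with ℕP.<-cmp (suc i) n
    ... | tri< i<n _ _  = ∣ₚ-*ʳ (Xpow (a * n * suc i))
                            (∣ₚ-*ˡ (twisted (a * n) (k ∸ suc i)) (Φ-∣-twisted n (suc i) (s≤s z≤n) i<n))
    ... | tri≈ _ refl _ = ∣ₚ-*ʳ (Xpow (a * n * n)) (∣ₚ-*ʳ (twisted n n) (Φ-∣-twisted-multiple a (k ∸ n) (∤-sub-n i≤k n∤k)))
    ... | tri> _ _ n<i  = ∣ₚ-zero (vandermondeTerm-beyond (a * n) k (suc i) n<i)

  -- Modulo Φ_n² only the terms i = 0 and i = n of Vandermonde survive for k = (b+1) n: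
  -- for 0 < i < n both twisted (A n) (k - i) and twisted n i are divisible by Φ_n.
  twisted-step : ∀ A b → twisted (suc A * n) (suc b * n) ≡[ P² ]
    twisted (A * n) (suc b * n) +ₚ twisted (A * n) (b * n) *ₚ (Xpow (choose2 n) *ₚ Xpow ((A * n) * n))
  twisted-step A b = ≡-trans (≈⇒≡ (vandermonde-multiple A k))
    (≡-trans (sum-≡-two P² (vandermondeTerm m n k) k n (s≤s z≤n) (ℕP.m≤m+n n (b * n)) others)
             (≈⇒≡ (+-cong (vandermondeTerm-0 m n k) term-n)))
    where
    m : ℕ
    m = A * n
    k : ℕ
    k = suc b * n
    others : ∀ i → 1 ≤ i → i ≤ k → i ≢ n → P² ∣ₚ vandermondeTerm m n k i
    others i i≥1 i≤k i≢n with ℕP.<-cmp i n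
    ... | tri< i<n _ _ = ∣ₚ-*ʳ (Xpow (m * i))
          (∣ₚ-* (Φ-∣-twisted-multiple A (k ∸ i) (∤-sub-small (n∣m*n (suc b)) i≥1 i<n i≤k)) (Φ-∣-twisted n i i≥1 i<n))
    ... | tri≈ _ i≡n _ = ⊥-elim (i≢n i≡n)
    ... | tri> _ _ n<i = ∣ₚ-zero (vandermondeTerm-beyond m k i n<i)
    term-n : vandermondeTerm m n k n ≈ twisted m (b * n) *ₚ (Xpow (choose2 n) *ₚ Xpow (m * n))
    term-n = ≈-trans (*-congˡ (Xpow (m * n)) (*-cong (≡⇒≈ (cong (twisted m) (ℕP.m+n∸m≡n n (b * n)))) (twisted-diag n)))
                     (*-assoc (twisted m (b * n)) (Xpow (choose2 n)) (Xpow (m * n)))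

  lhs : ℕ → ℕ → Poly
  lhs A b = constₚ (σ n ℤ.^ b) *ₚ twisted (A * n) (b * n)

  rhs : ℕ → ℕ → Poly
  rhs A b = natₚ ((A ∸ 1) C b) +ₚ natₚ ((A ∸ 1) C (A ∸ b)) *ₚ signedPower A

  lhs-step : ∀ A b → lhs (suc A) (suc b) ≡[ P² ] lhs A (suc b) +ₚ lhs A b *ₚ ratio A
  lhs-step A b = ≡-trans (≡-* (≈⇒≡ (const-* (σ n) (σ n ℤ.^ b))) (twisted-step A b))
    (≈⇒≡ (≈-trans (expand (constₚ (σ n)) (constₚ (σ n ℤ.^ b)) (twisted (A * n) (suc b * n)) (twisted (A * n) (b * n))
                           (Xpow (choose2 n)) (Xpow ((A * n) * n)))
                   (+-cong (*-congˡ (twisted (A * n) (suc b * n)) (≈-sym (const-* (σ n) (σ n ℤ.^ b)))) ≈-refl)))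
    where
    expand : ∀ s t c₁ c₂ x y → (s *ₚ t) *ₚ (c₁ +ₚ c₂ *ₚ (x *ₚ y)) ≈
                               (s *ₚ t) *ₚ c₁ +ₚ (t *ₚ c₂) *ₚ ((s *ₚ x) *ₚ y)
    expand s t c₁ c₂ x y = solve (s ∷ t ∷ c₁ ∷ c₂ ∷ x ∷ y ∷ []) Poly-ring

  -- Pascal's rule for the binomial coefficients, and w ≡ 1, Y ≡ 1 (mod Φ_n) making the
  -- error term k₀ (w - 1)(1 - Y) vanish modulo Φ_n².
  rhs-step : ∀ a b → b ≤ a →
    rhs (suc a) (suc b) +ₚ rhs (suc a) b *ₚ ratio (suc a) ≡[ P² ] rhs (suc (suc a)) (suc b)
  rhs-step a b b≤a =
    ≡-trans (≈⇒≡ regroup) (≡-trans (≡-+ ≡-refl error≡0) (≈⇒≡ (+ₚ-identityʳ (rhs (suc (suc a)) (suc b)))))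
    where
    A : ℕ
    A = suc a
    w : Poly
    w = ratio A
    Y : Poly
    Y = signedPower A
    k₀ : ℕ
    k₀ = a C b
    c₁ : ℕ
    c₁ = a C suc b
    c₃ : ℕ
    c₃ = a C suc (a ∸ b)
    symmetric : a C (a ∸ b) ≡ k₀
    symmetric = sym (nCk≡nC[n∸k] b≤a)
    A∸b : suc a ∸ b ≡ suc (a ∸ b)
    A∸b = ℕP.+-∸-assoc 1 b≤a
    pascal₁ : suc a C suc b ≡ k₀ + c₁
    pascal₁ = sym (nCk+nC[k+1]≡[n+1]C[k+1] a b)
    pascal₂ : suc a C (suc a ∸ b) ≡ k₀ + c₃
    pascal₂ = trans (cong (suc a C_) A∸b) (trans (sym (nCk+nC[k+1]≡[n+1]C[k+1] a (a ∸ b))) (cong (_+ c₃) symmetric))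
    collect : ∀ C₁ K₀ C₃ Y w → (C₁ +ₚ K₀ *ₚ Y) +ₚ (K₀ +ₚ C₃ *ₚ Y) *ₚ w ≈
              ((K₀ +ₚ C₁) +ₚ (K₀ +ₚ C₃) *ₚ (Y *ₚ w)) +ₚ K₀ *ₚ ((w +ₚ negₚ 𝟙) *ₚ (𝟙 +ₚ negₚ Y))
    collect C₁ K₀ C₃ Y w = solve (C₁ ∷ K₀ ∷ C₃ ∷ Y ∷ w ∷ []) Poly-ring
    regroup : rhs A (suc b) +ₚ rhs A b *ₚ w ≈ rhs (suc A) (suc b) +ₚ natₚ k₀ *ₚ ((w +ₚ negₚ 𝟙) *ₚ (𝟙 +ₚ negₚ Y))
    regroup = ≈-trans (+-cong (+-cong (≈-refl {natₚ c₁}) (*-congˡ Y (≡⇒≈ (cong natₚ symmetric))))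
                              (*-congˡ w (+-cong (≈-refl {natₚ k₀}) (*-congˡ Y (≡⇒≈ (cong (λ z → natₚ (a C z)) A∸b))))))
              (≈-trans (collect (natₚ c₁) (natₚ k₀) (natₚ c₃) Y w)
                       (+-cong (+-cong (≡⇒≈ (cong natₚ (sym pascal₁)))
                                       (*-cong (≡⇒≈ (cong natₚ (sym pascal₂))) (≈-sym (signedPower-suc A))))
                               ≈-refl))
    error≡0 : natₚ k₀ *ₚ ((w +ₚ negₚ 𝟙) *ₚ (𝟙 +ₚ negₚ Y)) ≡[ P² ] []
    error≡0 = ∣ₚ⇒≡0 (∣ₚ-*ˡ (natₚ k₀) (∣ₚ-* (difference (ratio≡1 A)) (difference (≡-sym (signedPower≡1 A)))))

  lhs≡rhs-0 : ∀ a → lhs (suc a) 0 ≈ rhs (suc a) 0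
  lhs≡rhs-0 a = begin
    lhs (suc a) 0                   ≈⟨ *-identityˡ (twisted (suc a * n) 0) ⟩
    twisted (suc a * n) 0           ≈⟨ twisted-0 (suc a * n) ⟩
    𝟙                               ≈⟨ ≈-sym (+ₚ-identityʳ 𝟙) ⟩
    𝟙 +ₚ []                         ≈⟨ ≈-sym (+-cong (natₚ-C-0 a) (*-congˡ (signedPower (suc a)) (natₚ-C-beyond a))) ⟩
    rhs (suc a) 0                   ∎
    where open ≈-Reasoning

  lhs≡rhs-top : ∀ a → lhs (suc a) (suc a) ≈ rhs (suc a) (suc a)
  lhs≡rhs-top a = begin
    lhs (suc a) (suc a)             ≈⟨ *-congʳ (constₚ (σ n ℤ.^ suc a)) (twisted-diag (suc a * n)) ⟩
    signedPower (suc a)             ≈⟨ ≈-sym (*-identityˡ (signedPower (suc a))) ⟩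
    𝟙 *ₚ signedPower (suc a)        ≈⟨ ≈-sym (+-cong (natₚ-C-beyond a) (*-congˡ (signedPower (suc a)) C-a-a)) ⟩
    rhs (suc a) (suc a)             ∎
    where
    open ≈-Reasoning
    C-a-a : natₚ (a C (a ∸ a)) ≈ 𝟙
    C-a-a = ≈-trans (≡⇒≈ (cong (λ z → natₚ (a C z)) (ℕP.n∸n≡0 a))) (natₚ-C-0 a)

  lhs≡rhs : ∀ a b → b ≤ suc a → lhs (suc a) b ≡[ P² ] rhs (suc a) b
  lhs≡rhs a       zero          _ = ≈⇒≡ (lhs≡rhs-0 a)
  lhs≡rhs zero    (suc zero)    _ = ≈⇒≡ (lhs≡rhs-top 0)
  lhs≡rhs zero    (suc (suc b)) (s≤s ())
  lhs≡rhs (suc a) (suc b) b≤a with ℕP.m≤n⇒m<n∨m≡n b≤a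
  ... | inj₂ refl = ≈⇒≡ (lhs≡rhs-top (suc a))
  ... | inj₁ (s≤s (s≤s b<a)) = ≡-trans (lhs-step (suc a) b)
    (≡-trans (≡-+ (lhs≡rhs a (suc b) (s≤s b<a)) (≡-* (lhs≡rhs a b (ℕP.m≤n⇒m≤1+n b<a)) ≡-refl))
             (rhs-step a b b<a))

mainTheorem1 : (n a b : ℕ) → 1 ≤ n → 1 ≤ a → b ≤ a →
    CongMod
      (scaleₚ (σ n ℤ.^ b) (qbinom (a * n) (b * n) *ₚ Xpow ((b * n) C 2)))
      (constₚ (+ ((a ∸ 1) C b))
        +ₚ scaleₚ ((+ ((a ∸ 1) C (a ∸ b))) ℤ.* (σ n ℤ.^ a)) (Xpow ((a * n) C 2)))
      (Φ n *ₚ Φ n)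
mainTheorem1 (suc n′) (suc a′) b _ _ b≤a =
  ≡⇒CongMod (≡-trans (≈⇒≡ left) (≡-trans (lhs≡rhs a′ b b≤a) (≈⇒≡ right)))
  where
  open ModuloΦ² n′
  a : ℕ
  a = suc a′
  c : ℤ
  c = + ((a ∸ 1) C (a ∸ b))
  left : scaleₚ (σ n ℤ.^ b) (qbinom (a * n) (b * n) *ₚ Xpow ((b * n) C 2)) ≈ lhs a b
  left = ≈-trans (scale≈const* (σ n ℤ.^ b) (qbinom (a * n) (b * n) *ₚ Xpow ((b * n) C 2)))
    (*-congʳ (constₚ (σ n ℤ.^ b))
      (≈-trans (*-cong (qbinom≈qbin (a * n) (b * n) (ℕP.*-monoˡ-≤ n b≤a)) (≡⇒≈ (cong Xpow (sym (choose2≡C2 (b * n))))))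
               (*-comm (qbin (a * n) (b * n)) (Xpow (choose2 (b * n))))))
  right : rhs a b ≈ constₚ (+ ((a ∸ 1) C b)) +ₚ scaleₚ (c ℤ.* (σ n ℤ.^ a)) (Xpow ((a * n) C 2))
  right = +-cong (≈-refl {natₚ ((a ∸ 1) C b)}) (≈-sym
    (≈-trans (scale≈const* (c ℤ.* (σ n ℤ.^ a)) (Xpow ((a * n) C 2)))
    (≈-trans (*-cong (const-* c (σ n ℤ.^ a)) (≡⇒≈ (cong Xpow (sym (choose2≡C2 (a * n))))))
             (*-assoc (constₚ c) (constₚ (σ n ℤ.^ a)) (Xpow (choose2 (a * n)))))))
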